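{- Let $\langle k\rangle=(k,k-1,\dots,1)\in S_k$ and $\Phi(x,y)=\sum_{k\ge1}F_{\langle k\rangle}(x)y^k$. Then $$\Phi(x,y)=\frac{y(1+x-xy)-y\sqrt{(1+x-xy)^2-4x}}{2x(1-y)}.$$
   Context: A permutation $\alpha\in S_n$ contains a pattern $\tau\in S_k$ if there are indices $1\le i_1<\dots<i_k\le n$ with $(\alpha_{i_1},\dots,\alpha_{i_k})$ order-isomorphic to $\tau$; otherwise it avoids $\tau$. For a pattern $\tau$, $f_\tau(n)$ is the number of permutations in $S_n$ avoiding both $132$ and $\tau$ ($S_0$ consists of the empty permutation), and $F_\tau(x)=\sum_{n\ge0}f_\tau(n)x^n$. -}

module Defs where

open import Data.Nat using (ℕ; zero; suc; _∸_; _<ᵇ_; _≡ᵇ_)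
open import Data.Bool using (Bool; true; false; _∧_; not; if_then_else_)
open import Data.Bool.Properties using () renaming (_≟_ to _≟B_)
open import Data.Fin using (Fin; toℕ)
open import Data.Vec using (Vec; []; _∷_; toList)
import Data.Vec as Vec
open import Data.List using (List; []; _∷_; [_]; length; map; filter; concatMap; allFin; zip; upTo; downFrom; foldr)
open import Data.Bool.ListAction using (any; all)
open import Data.Product using (_×_; _,_; proj₁; proj₂)
open import Data.Integer using (ℤ; +_) renaming (_+_ to _+ℤ_; _*_ to _*ℤ_; -_ to -ℤ_)
open import Relation.Nullary.Decidable using (⌊_⌋)
open import Relation.Binary.PropositionalEquality using (_≡_)

allVecs : (m n : ℕ) → List (Vec (Fin n) m)
allVecs zero    n = [ [] ]
allVecs (suc m) n = concatMap (λ i → map (i ∷_) (allVecs m n)) (allFin n)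

word : {m n : ℕ} → Vec (Fin n) m → List ℕ
word v = toList (Vec.map toℕ v)

distinct : List ℕ → Bool
distinct []       = true
distinct (x ∷ xs) = all (λ y → not (x ≡ᵇ y)) xs ∧ distinct xs

-- S_n : the permutations of {0,…,n-1} in one-line notation
-- (words of length n over Fin n with distinct entries)
Sym : ℕ → List (List ℕ)
Sym n = filter (λ w → distinct w ≟B true) (map word (allVecs n n))

subseqs : ℕ → List ℕ → List (List ℕ)
subseqs zero    _        = [ [] ]
subseqs (suc k) []       = []
subseqs (suc k) (x ∷ xs) = map (x ∷_) (subseqs k xs) Data.List.++ subseqs (suc k) xs

orderIso : List ℕ → List ℕ → Bool
orderIso xs ys =
  (length xs ≡ᵇ length ys) ∧
  all (λ p → all (λ q → ⌊ (proj₁ p <ᵇ proj₁ q) ≟B (proj₂ p <ᵇ proj₂ q) ⌋) zs) zs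
  where zs = zip xs ys

contains : List ℕ → List ℕ → Bool
contains α τ = any (orderIso τ) (subseqs (length τ) α)

avoids : List ℕ → List ℕ → Bool
avoids α τ = not (contains α τ)

p132 : List ℕ
p132 = 1 ∷ 3 ∷ 2 ∷ []

f : List ℕ → ℕ → ℕ
f τ n = length (filter (λ α → (avoids α p132 ∧ avoids α τ) ≟B true) (Sym n))

-- ⟨k⟩ = (k, k-1, …, 1)  (written with values k-1,…,0; only the order type matters)
dec : ℕ → List ℕ
dec k = downFrom k

-- Formal power series in x, y with integer coefficients:
-- A n k is the coefficient of x^n y^k.

sumℤ : List ℤ → ℤ
sumℤ = foldr _+ℤ_ (+ 0)

Series : Set
Series = ℕ → ℕ → ℤ

_⊕_ : Series → Series → Series
(A ⊕ B) n k = A n k +ℤ B n k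

_⊖_ : Series → Series → Series
(A ⊖ B) n k = A n k +ℤ (-ℤ (B n k))

_⊗_ : Series → Series → Series
(A ⊗ B) n k =
  sumℤ (map (λ i → sumℤ (map (λ j → A i j *ℤ B (n ∸ i) (k ∸ j)) (upTo (suc k)))) (upTo (suc n)))

const : ℤ → Series
const c zero zero = c
const c _    _    = + 0

X : Series
X (suc zero) zero = + 1
X _ _ = + 0

Y : Series
Y zero (suc zero) = + 1
Y _ _ = + 0

Φ : Series
Φ n zero    = + 0
Φ n (suc k) = + f (dec (suc k)) n

Disc : Series
Disc = (L ⊗ L) ⊖ (const (+ 4) ⊗ X)
  where L = (const (+ 1) ⊕ X) ⊖ (X ⊗ Y)

-- A 132-avoiding permutation of length n + 1 splits around its maximum n as (β + |γ|) n γ,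
-- with β and γ 132-avoiding and every entry of β above every entry of γ; conversely every such
-- concatenation avoids 132. Its longest decreasing subsequence then has length lds β + lds γ if β
-- is nonempty and 1 + lds γ otherwise, so H(x, y) = Σ_α x^|α| y^(lds α) satisfies
-- H = 1 + xyH + x(H - 1)H, i.e. xH² - LH + 1 = 0 with L = 1 + x - xy. Since F_⟨k⟩ counts the α
-- with lds α < k, (1 - y)Φ = yH. For S = L - 2xH the quadratic gives S² = L² - 4x, and
-- 2x(1 - y)Φ = 2xyH = yL - yS.

module Submission where

open import Defs
open import Level using (Level)
open import Data.Nat using (ℕ; zero; suc; _∸_; _<ᵇ_; _≡ᵇ_)
import Data.Nat as ℕ
import Relation.Binary.PropositionalEquality as ≡
open import Data.Bool using (if_then_else_)
open import Data.List using (List; []; _∷_; _++_; map; foldr; concatMap; cartesianProduct; applyUpTo; upTo)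
open import Data.List.Properties using (map-upTo)
open import Data.List.Membership.Propositional using (_∈_)
open import Data.List.Relation.Unary.Any using (here; there)
open import Data.Product using (Σ; _×_; _,_)
open import Relation.Binary.PropositionalEquality using (_≡_)
open import Function using (_∘_)
open import Algebra.Bundles using (Semiring; CommutativeRing)
open import Relation.Binary.Structures using (IsEquivalence)
import Relation.Binary.Reasoning.Setoid as SetoidReasoning
import Algebra.Properties.CommutativeSemigroup as CommSemigroupProperties
import Algebra.Properties.Ring as RingProperties


module ListSum {c ℓ} (R : Semiring c ℓ) where
  open Semiring R

  private variable
    a b : Level
    A : Set a
    B : Set b

  sum : List Carrier → Carrier
  sum = foldr _+_ 0#

  ∑ : List A → (A → Carrier) → Carrier
  ∑ xs f = sum (map f xs)

  infix 6 ∑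
  syntax ∑ xs (λ x → e) = ∑[ x ∈ xs ] e

  ∑-cong : ∀ (xs : List A) {f g : A → Carrier} → (∀ {x} → x ∈ xs → f x ≈ g x) → ∑ xs f ≈ ∑ xs g
  ∑-cong []       f≈g = refl
  ∑-cong (x ∷ xs) f≈g = +-cong (f≈g (here ≡.refl)) (∑-cong xs (f≈g ∘ there))

  ∑-map : ∀ (g : A → B) (xs : List A) (f : B → Carrier) → ∑ (map g xs) f ≈ ∑ xs (f ∘ g)
  ∑-map g []       f = refl
  ∑-map g (x ∷ xs) f = +-congˡ (∑-map g xs f)

  ∑-++ : ∀ (xs ys : List A) (f : A → Carrier) → ∑ (xs ++ ys) f ≈ ∑ xs f + ∑ ys f
  ∑-++ []       ys f = sym (+-identityˡ _)
  ∑-++ (x ∷ xs) ys f = trans (+-congˡ (∑-++ xs ys f)) (sym (+-assoc _ _ _))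

  ∑-concatMap : ∀ (g : A → List B) (xs : List A) (f : B → Carrier) →
                ∑ (concatMap g xs) f ≈ ∑[ x ∈ xs ] ∑ (g x) f
  ∑-concatMap g []       f = refl
  ∑-concatMap g (x ∷ xs) f = trans (∑-++ (g x) (concatMap g xs) f) (+-congˡ (∑-concatMap g xs f))

  *-distribˡ-∑ : ∀ y (xs : List A) (f : A → Carrier) → y * ∑ xs f ≈ ∑[ x ∈ xs ] (y * f x)
  *-distribˡ-∑ y []       f = zeroʳ y
  *-distribˡ-∑ y (x ∷ xs) f = trans (distribˡ y _ _) (+-congˡ (*-distribˡ-∑ y xs f))

  *-distribʳ-∑ : ∀ y (xs : List A) (f : A → Carrier) → ∑ xs f * y ≈ ∑[ x ∈ xs ] (f x * y)
  *-distribʳ-∑ y []       f = zeroˡ y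
  *-distribʳ-∑ y (x ∷ xs) f = trans (distribʳ y _ _) (+-congˡ (*-distribʳ-∑ y xs f))

  ∑-cartesianProduct : ∀ (xs : List A) (ys : List B) (f : A × B → Carrier) →
                       ∑ (cartesianProduct xs ys) f ≈ ∑[ x ∈ xs ] ∑[ y ∈ ys ] f (x , y)
  ∑-cartesianProduct []       ys f = refl
  ∑-cartesianProduct (x ∷ xs) ys f = trans (∑-++ (map (x ,_) ys) (cartesianProduct xs ys) f)
    (+-cong (∑-map (x ,_) ys f) (∑-cartesianProduct xs ys f))

  ∑-*-∑ : ∀ (xs : List A) (ys : List B) (f : A → Carrier) (g : B → Carrier) →
          ∑ xs f * ∑ ys g ≈ ∑[ x ∈ xs ] ∑[ y ∈ ys ] (f x * g y)
  ∑-*-∑ xs ys f g = trans (*-distribʳ-∑ (∑ ys g) xs f) (∑-cong xs λ {x} _ → *-distribˡ-∑ (f x) ys g)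

  ∑-zero : ∀ (xs : List A) → ∑[ x ∈ xs ] 0# ≈ 0#
  ∑-zero []       = refl
  ∑-zero (x ∷ xs) = trans (+-identityˡ _) (∑-zero xs)


module PowerSeries {c ℓ} (R : CommutativeRing c ℓ) where
  open CommutativeRing R
  open SetoidReasoning setoid
  open CommSemigroupProperties +-commutativeSemigroup using (interchange)
  open RingProperties ring using (-0#≈0#)

  PS : Set c
  PS = ℕ → Carrier

  infix 4 _≋_
  _≋_ : PS → PS → Set ℓ
  f ≋ g = ∀ n → f n ≈ g n

  infixl 6 _+ₚ_
  _+ₚ_ : PS → PS → PS
  (f +ₚ g) n = f n + g n

  -ₚ_ : PS → PS
  (-ₚ f) n = - f n

  0ₚ : PS
  0ₚ n = 0#

  1ₚ : PS
  1ₚ zero    = 1#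
  1ₚ (suc n) = 0#

  tail : PS → PS
  tail f n = f (suc n)

  infixl 7 _*ₚ_
  _*ₚ_ : PS → PS → PS
  (f *ₚ g) zero    = f 0 * g 0
  (f *ₚ g) (suc n) = f 0 * g (suc n) + (tail f *ₚ g) n

  scale : Carrier → PS → PS
  scale a f n = a * f n

  *ₚ-cong : ∀ {f f′ g g′} → f ≋ f′ → g ≋ g′ → f *ₚ g ≋ f′ *ₚ g′
  *ₚ-cong f≋ g≋ zero    = *-cong (f≋ 0) (g≋ 0)
  *ₚ-cong f≋ g≋ (suc n) = +-cong (*-cong (f≋ 0) (g≋ (suc n))) (*ₚ-cong (f≋ ∘ suc) g≋ n)

  *ₚ-distribʳ : ∀ f f′ g → (f +ₚ f′) *ₚ g ≋ f *ₚ g +ₚ f′ *ₚ g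
  *ₚ-distribʳ f f′ g zero    = distribʳ (g 0) (f 0) (f′ 0)
  *ₚ-distribʳ f f′ g (suc n) =
    trans (+-cong (distribʳ _ _ _) (*ₚ-distribʳ (tail f) (tail f′) g n)) (interchange _ _ _ _)

  *ₚ-distribˡ : ∀ f g g′ → f *ₚ (g +ₚ g′) ≋ f *ₚ g +ₚ f *ₚ g′
  *ₚ-distribˡ f g g′ zero    = distribˡ (f 0) (g 0) (g′ 0)
  *ₚ-distribˡ f g g′ (suc n) =
    trans (+-cong (distribˡ _ _ _) (*ₚ-distribˡ (tail f) g g′ n)) (interchange _ _ _ _)

  scale-*ₚ : ∀ a f g → scale a f *ₚ g ≋ scale a (f *ₚ g)
  scale-*ₚ a f g zero    = *-assoc _ _ _
  scale-*ₚ a f g (suc n) = trans (+-cong (*-assoc _ _ _) (scale-*ₚ a (tail f) g n)) (sym (distribˡ a _ _))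

  *ₚ-zeroˡ : ∀ g → 0ₚ *ₚ g ≋ 0ₚ
  *ₚ-zeroˡ g zero    = zeroˡ _
  *ₚ-zeroˡ g (suc n) = trans (+-cong (zeroˡ _) (*ₚ-zeroˡ g n)) (+-identityˡ _)

  *ₚ-identityˡ : ∀ g → 1ₚ *ₚ g ≋ g
  *ₚ-identityˡ g zero    = *-identityˡ _
  *ₚ-identityˡ g (suc n) = trans (+-cong (*-identityˡ _) (*ₚ-zeroˡ g n)) (+-identityʳ _)

  *ₚ-assoc : ∀ f g h → (f *ₚ g) *ₚ h ≋ f *ₚ (g *ₚ h)
  *ₚ-assoc f g h zero    = *-assoc _ _ _
  *ₚ-assoc f g h (suc n) = begin
    (f 0 * g 0) * h (suc n) + ((scale (f 0) (tail g) +ₚ tail f *ₚ g) *ₚ h) n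
      ≈⟨ +-cong (*-assoc _ _ _) (*ₚ-distribʳ (scale (f 0) (tail g)) (tail f *ₚ g) h n) ⟩
    f 0 * (g 0 * h (suc n)) + ((scale (f 0) (tail g) *ₚ h) n + ((tail f *ₚ g) *ₚ h) n)
      ≈⟨ +-congˡ (+-cong (scale-*ₚ (f 0) (tail g) h n) (*ₚ-assoc (tail f) g h n)) ⟩
    f 0 * (g 0 * h (suc n)) + (f 0 * (tail g *ₚ h) n + (tail f *ₚ (g *ₚ h)) n)
      ≈⟨ sym (+-assoc _ _ _) ⟩
    (f 0 * (g 0 * h (suc n)) + f 0 * (tail g *ₚ h) n) + (tail f *ₚ (g *ₚ h)) n
      ≈⟨ +-congʳ (sym (distribˡ _ _ _)) ⟩
    f 0 * (g *ₚ h) (suc n) + (tail f *ₚ (g *ₚ h)) n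
      ∎

  *ₚ-peelʳ : ∀ f g n → (f *ₚ g) (suc n) ≈ (f *ₚ tail g) n + f (suc n) * g 0
  *ₚ-peelʳ f g zero    = refl
  *ₚ-peelʳ f g (suc n) = trans (+-congˡ (*ₚ-peelʳ (tail f) g n)) (sym (+-assoc _ _ _))

  *ₚ-comm : ∀ f g → f *ₚ g ≋ g *ₚ f
  *ₚ-comm f g zero    = *-comm _ _
  *ₚ-comm f g (suc n) = begin
    f 0 * g (suc n) + (tail f *ₚ g) n   ≈⟨ +-cong (*-comm _ _) (*ₚ-comm (tail f) g n) ⟩
    g (suc n) * f 0 + (g *ₚ tail f) n   ≈⟨ +-comm _ _ ⟩
    (g *ₚ tail f) n + g (suc n) * f 0   ≈⟨ sym (*ₚ-peelʳ g f n) ⟩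
    (g *ₚ f) (suc n)                    ∎

  ≋-isEquivalence : IsEquivalence _≋_
  ≋-isEquivalence = record
    { refl = λ n → refl ; sym = λ f≋g n → sym (f≋g n) ; trans = λ f≋g g≋h n → trans (f≋g n) (g≋h n) }

  psRing : CommutativeRing c ℓ
  psRing = record
    { Carrier = PS ; _≈_ = _≋_ ; _+_ = _+ₚ_ ; _*_ = _*ₚ_ ; -_ = -ₚ_ ; 0# = 0ₚ ; 1# = 1ₚ
    ; isCommutativeRing = record
      { isRing = record
        { +-isAbelianGroup = record
          { isGroup = record
            { isMonoid = record
              { isSemigroup = record
                { isMagma = record
                  { isEquivalence = ≋-isEquivalence ; ∙-cong = λ f≋ g≋ n → +-cong (f≋ n) (g≋ n) }
                ; assoc = λ f g h n → +-assoc (f n) (g n) (h n) }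
              ; identity = (λ f n → +-identityˡ (f n)) , (λ f n → +-identityʳ (f n)) }
            ; inverse = (λ f n → -‿inverseˡ (f n)) , (λ f n → -‿inverseʳ (f n))
            ; ⁻¹-cong = λ f≋ n → -‿cong (f≋ n) }
          ; comm = λ f g n → +-comm (f n) (g n) }
        ; *-cong = *ₚ-cong
        ; *-assoc = *ₚ-assoc
        ; *-identity = *ₚ-identityˡ , (λ f n → trans (*ₚ-comm f 1ₚ n) (*ₚ-identityˡ f n))
        ; distrib = *ₚ-distribˡ , (λ h f g n → trans (*ₚ-comm (f +ₚ g) h n)
                      (trans (*ₚ-distribˡ h f g n) (+-cong (*ₚ-comm h f n) (*ₚ-comm h g n))))
        }
      ; *-comm = *ₚ-comm
      }
    }

  C : Carrier → PS
  C a zero    = a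
  C a (suc n) = 0#

  C-cong : ∀ {a b} → a ≈ b → C a ≋ C b
  C-cong a≈b zero    = a≈b
  C-cong a≈b (suc n) = refl

  C-*ₚ : ∀ a f → C a *ₚ f ≋ scale a f
  C-*ₚ a f zero    = refl
  C-*ₚ a f (suc n) = trans (+-congˡ (*ₚ-zeroˡ f n)) (+-identityʳ _)

  C-+ : ∀ a b → C (a + b) ≋ C a +ₚ C b
  C-+ a b zero    = refl
  C-+ a b (suc n) = sym (+-identityʳ _)

  C-* : ∀ a b → C (a * b) ≋ C a *ₚ C b
  C-* a b zero    = refl
  C-* a b (suc n) = sym (trans (C-*ₚ a (C b) (suc n)) (zeroʳ a))

  C-neg : ∀ a → C (- a) ≋ -ₚ C a
  C-neg a zero    = refl
  C-neg a (suc n) = sym -0#≈0#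

  C-0 : C 0# ≋ 0ₚ
  C-0 zero    = refl
  C-0 (suc n) = refl

  C-1 : C 1# ≋ 1ₚ
  C-1 zero    = refl
  C-1 (suc n) = refl

  mono : ℕ → PS
  mono a k = if a ≡ᵇ k then 1# else 0#

  𝕩 : PS
  𝕩 = mono 1

  shift : PS → PS
  shift f zero    = 0#
  shift f (suc n) = f n

  𝕩-*ₚ : ∀ f → 𝕩 *ₚ f ≋ shift f
  𝕩-*ₚ f zero    = zeroˡ _
  𝕩-*ₚ f (suc n) = begin
    0# * f (suc n) + (tail 𝕩 *ₚ f) n  ≈⟨ +-cong (zeroˡ _) (*ₚ-cong tail𝕩≋1 (λ _ → refl) n) ⟩
    0# + (1ₚ *ₚ f) n                  ≈⟨ +-identityˡ _ ⟩
    (1ₚ *ₚ f) n                       ≈⟨ *ₚ-identityˡ f n ⟩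
    f n                               ∎
    where
    tail𝕩≋1 : tail 𝕩 ≋ 1ₚ
    tail𝕩≋1 zero    = refl
    tail𝕩≋1 (suc n) = refl

  mono-zero : mono 0 ≋ 1ₚ
  mono-zero zero    = refl
  mono-zero (suc n) = refl

  mono-suc : ∀ a → mono (suc a) ≋ 𝕩 *ₚ mono a
  mono-suc a n = sym (trans (𝕩-*ₚ (mono a) n) (shifted n))
    where
    shifted : shift (mono a) ≋ mono (suc a)
    shifted zero    = refl
    shifted (suc n) = refl

  mono-+ : ∀ a b → mono (a ℕ.+ b) ≋ mono a *ₚ mono b
  mono-+ zero    b n = sym (trans (*ₚ-cong mono-zero (λ _ → refl) n) (*ₚ-identityˡ (mono b) n))
  mono-+ (suc a) b n = begin
    mono (suc a ℕ.+ b) n         ≈⟨ mono-suc (a ℕ.+ b) n ⟩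
    (𝕩 *ₚ mono (a ℕ.+ b)) n      ≈⟨ *ₚ-cong (λ _ → refl) (mono-+ a b) n ⟩
    (𝕩 *ₚ (mono a *ₚ mono b)) n  ≈⟨ sym (*ₚ-assoc 𝕩 (mono a) (mono b) n) ⟩
    ((𝕩 *ₚ mono a) *ₚ mono b) n  ≈⟨ *ₚ-cong (λ k → sym (mono-suc a k)) (λ _ → refl) n ⟩
    (mono (suc a) *ₚ mono b) n   ∎

  geom : ℕ → PS
  geom a k = if a <ᵇ k then 1# else 0#

  geom-step : ∀ a k → geom a (suc k) - geom a k ≈ mono a k
  geom-step zero    zero    = trans (+-congˡ -0#≈0#) (+-identityʳ 1#)
  geom-step zero    (suc k) = -‿inverseʳ 1#
  geom-step (suc a) zero    = trans (+-congˡ -0#≈0#) (+-identityʳ 0#)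
  geom-step (suc a) (suc k) = geom-step a k

  1-𝕩-*ₚ-geom : ∀ a → (1ₚ +ₚ -ₚ 𝕩) *ₚ geom a ≋ mono (suc a)
  1-𝕩-*ₚ-geom a n = begin
    ((1ₚ +ₚ -ₚ 𝕩) *ₚ geom a) n                   ≈⟨ [y-z]x≈yx-zx (geom a) 1ₚ 𝕩 n ⟩
    (1ₚ *ₚ geom a) n + - (𝕩 *ₚ geom a) n
      ≈⟨ +-cong (*ₚ-identityˡ (geom a) n) (-‿cong (𝕩-*ₚ (geom a) n)) ⟩
    geom a n - shift (geom a) n                  ≈⟨ difference n ⟩
    mono (suc a) n                               ∎
    where
    open RingProperties (CommutativeRing.ring psRing) using ([y-z]x≈yx-zx)
    difference : ∀ n → geom a n - shift (geom a) n ≈ mono (suc a) n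
    difference zero    = trans (+-congˡ -0#≈0#) (+-identityʳ 0#)
    difference (suc n) = geom-step a n

  open ListSum semiring using (sum; ∑)
  open ListSum (CommutativeRing.semiring psRing) using () renaming (∑ to ∑ₚ)

  ∑-coeff : ∀ {a} {A : Set a} (xs : List A) (f : A → PS) n → ∑ₚ xs f n ≈ ∑ xs (λ x → f x n)
  ∑-coeff []       f n = refl
  ∑-coeff (x ∷ xs) f n = +-congˡ (∑-coeff xs f n)

  *ₚ-coeff : ∀ f g n → (f *ₚ g) n ≈ ∑ (upTo (suc n)) (λ i → f i * g (n ∸ i))
  *ₚ-coeff f g n = trans (convolution f g n) (reflexive (≡.cong sum (≡.sym (map-upTo _ (suc n)))))
    where
    convolution : ∀ f g n → (f *ₚ g) n ≈ sum (applyUpTo (λ i → f i * g (n ∸ i)) (suc n))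
    convolution f g zero    = sym (+-identityʳ _)
    convolution f g (suc n) = +-congˡ (convolution (tail f) g n)


module Sublists where

  open import Data.List using (List; []; _∷_; map; _++_)
  open import Data.List.Relation.Unary.AllPairs using (AllPairs; []; _∷_)
  open import Data.List.Relation.Binary.Sublist.Propositional using (_⊆_; []; _∷_; _∷ʳ_)
  open import Data.List.Relation.Binary.Sublist.Propositional.Properties using (All-resp-⊆)
  open import Data.Product using (∃; ∃₂; _×_; _,_)
  open import Relation.Binary.Core using (Rel)
  open import Relation.Binary.PropositionalEquality using (_≡_; refl)

  private variable
    a r : Level
    A B : Set a

  AllPairs-resp-⊇ : ∀ {R : Rel A r} {xs ys} → xs ⊆ ys → AllPairs R ys → AllPairs R xs
  AllPairs-resp-⊇ []          []         = []
  AllPairs-resp-⊇ (y ∷ʳ xs⊆)  (_ ∷ rys)  = AllPairs-resp-⊇ xs⊆ rys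
  AllPairs-resp-⊇ (refl ∷ xs⊆) (ry ∷ rys) = All-resp-⊆ xs⊆ ry ∷ AllPairs-resp-⊇ xs⊆ rys

  ⊆-++-split : ∀ (xs : List A) {ys s} → s ⊆ xs ++ ys →
               ∃₂ λ s₁ s₂ → s ≡ s₁ ++ s₂ × s₁ ⊆ xs × s₂ ⊆ ys
  ⊆-++-split []       s⊆ys         = [] , _ , refl , [] , s⊆ys
  ⊆-++-split (x ∷ xs) (_ ∷ʳ s⊆)    =
    let s₁ , s₂ , eq , s₁⊆ , s₂⊆ = ⊆-++-split xs s⊆ in s₁ , s₂ , eq , x ∷ʳ s₁⊆ , s₂⊆
  ⊆-++-split (x ∷ xs) (refl ∷ s⊆) with s₁ , s₂ , refl , s₁⊆ , s₂⊆ ← ⊆-++-split xs s⊆ =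
    x ∷ s₁ , s₂ , refl , refl ∷ s₁⊆ , s₂⊆

  ⊆-map⁻ : ∀ (f : A → B) xs {s} → s ⊆ map f xs → ∃ λ s′ → s ≡ map f s′ × s′ ⊆ xs
  ⊆-map⁻ f []       []          = [] , refl , []
  ⊆-map⁻ f (x ∷ xs) (_ ∷ʳ s⊆)   = let s′ , eq , s′⊆ = ⊆-map⁻ f xs s⊆ in s′ , eq , x ∷ʳ s′⊆
  ⊆-map⁻ f (x ∷ xs) (refl ∷ s⊆) with s′ , refl , s′⊆ ← ⊆-map⁻ f xs s⊆ =
    x ∷ s′ , refl , refl ∷ s′⊆


module UniqueLists where

  open import Data.Nat using (suc; _+_; _∸_; _<_; _≤_; z≤n; s≤s)
  import Data.Nat.Properties as ℕ
  open import Data.List using (List; []; _∷_; length; map; _++_; applyUpTo)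
  open import Data.List.Properties using (length-++-sucʳ; length-applyUpTo; ∷-injective)
  open import Data.List.Membership.Propositional using (_∈_)
  open import Data.List.Membership.Propositional.Properties
    using (∈-∃++; ∈-++⁻; ∈-++⁺ˡ; ∈-++⁺ʳ; ∈-applyUpTo⁺)
  open import Data.List.Relation.Unary.All as All using (All; []; _∷_)
  import Data.List.Relation.Unary.All.Properties as All
  open import Data.List.Relation.Unary.Any using (here; there)
  open import Data.List.Relation.Unary.AllPairs using ([]; _∷_)
  open import Data.List.Relation.Unary.Unique.Propositional using (Unique)
  open import Data.List.Relation.Binary.Sublist.Propositional using (_⊆_)
  open import Data.Product using (_×_; _,_; proj₁; proj₂)
  open import Data.Sum using (inj₁; inj₂)
  open import Data.Empty using (⊥-elim)
  open import Function using (_⇔_)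
  open import Function.Bundles using (module Equivalence)
  open import Relation.Binary.PropositionalEquality using (_≡_; _≢_; refl; sym; cong; subst)
  open Sublists

  private variable
    a b : Level
    A : Set a
    B : Set b

  Unique⇒length≤ : ∀ {xs ys : List A} → Unique xs → (∀ {z} → z ∈ xs → z ∈ ys) → length xs ≤ length ys
  Unique⇒length≤ {xs = []}     _          _     = z≤n
  Unique⇒length≤ {xs = x ∷ xs} (x∉ ∷ uxs) xs⊆ys with ys₁ , ys₂ , refl ← ∈-∃++ (xs⊆ys (here refl)) =
    subst (suc (length xs) ≤_) (sym (length-++-sucʳ ys₁ x ys₂)) (s≤s (Unique⇒length≤ uxs xs⊆ys₁++ys₂))
    where
    xs⊆ys₁++ys₂ : ∀ {z} → z ∈ xs → z ∈ ys₁ ++ ys₂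
    xs⊆ys₁++ys₂ z∈xs with ∈-++⁻ ys₁ (xs⊆ys (there z∈xs))
    ... | inj₁ z∈ys₁         = ∈-++⁺ˡ z∈ys₁
    ... | inj₂ (here z≡x)    = ⊥-elim (All.lookup x∉ z∈xs (sym z≡x))
    ... | inj₂ (there z∈ys₂) = ∈-++⁺ʳ ys₁ z∈ys₂

  Unique⇒length≡ : ∀ {xs ys : List A} → Unique xs → Unique ys →
                   (∀ {z} → z ∈ xs ⇔ z ∈ ys) → length xs ≡ length ys
  Unique⇒length≡ uxs uys xs⇔ys =
    ℕ.≤-antisym (Unique⇒length≤ uxs (Equivalence.to xs⇔ys)) (Unique⇒length≤ uys (Equivalence.from xs⇔ys))

  Unique-bounded⇒length≤ : ∀ {m n xs} → Unique xs → All (λ y → m ≤ y × y < n) xs → length xs ≤ n ∸ m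
  Unique-bounded⇒length≤ {m} {n} uxs bounded =
    subst (_ ≤_) (length-applyUpTo (m +_) (n ∸ m)) (Unique⇒length≤ uxs in-range)
    where
    in-range : ∀ {y} → y ∈ _ → y ∈ applyUpTo (m +_) (n ∸ m)
    in-range y∈ with m≤y , y<n ← All.lookup bounded y∈ =
      subst (_∈ _) (ℕ.m+[n∸m]≡n m≤y) (∈-applyUpTo⁺ (m +_) (ℕ.∸-monoˡ-< y<n m≤y))

  Unique⇒≢ : ∀ {x y : A} {w} → Unique w → x ∷ y ∷ [] ⊆ w → x ≢ y
  Unique⇒≢ uw xy⊆w with (x≢y ∷ []) ∷ _ ← AllPairs-resp-⊇ xy⊆w uw = x≢y

  Unique-map⁺-on : ∀ {f : A → B} {xs} →
                   (∀ {x y} → x ∈ xs → y ∈ xs → f x ≡ f y → x ≡ y) →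
                   Unique xs → Unique (map f xs)
  Unique-map⁺-on {xs = []}     _   []         = []
  Unique-map⁺-on {xs = x ∷ xs} inj (x∉ ∷ uxs) =
    All.map⁺ (All.tabulate λ y∈ fx≡fy → All.lookup x∉ y∈ (inj (here refl) (there y∈) fx≡fy))
    ∷ Unique-map⁺-on (λ x∈ y∈ → inj (there x∈) (there y∈)) uxs

  ++-∷-cancel : ∀ {m : A} xs xs′ {ys ys′} → All (_≢ m) xs → All (_≢ m) xs′ →
                xs ++ m ∷ ys ≡ xs′ ++ m ∷ ys′ → xs ≡ xs′ × ys ≡ ys′
  ++-∷-cancel []       []         _          _            eq = refl , proj₂ (∷-injective eq)
  ++-∷-cancel []       (x′ ∷ xs′) _          (x′≢m ∷ _)   eq =
    ⊥-elim (x′≢m (sym (proj₁ (∷-injective eq))))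
  ++-∷-cancel (x ∷ xs) []         (x≢m ∷ _)  _            eq = ⊥-elim (x≢m (proj₁ (∷-injective eq)))
  ++-∷-cancel (x ∷ xs) (x′ ∷ xs′) (_ ∷ xs≢m) (_ ∷ xs′≢m) eq with refl , eq′ ← ∷-injective eq =
    let xs≡ , ys≡ = ++-∷-cancel xs xs′ xs≢m xs′≢m eq′ in cong (x ∷_) xs≡ , ys≡


module Patterns where

  open import Data.Nat using (ℕ; zero; suc; _<_; _≤_; _>_; _<ᵇ_; s≤s)
  open import Data.Nat.Properties as ℕ using (<⇒<ᵇ; <ᵇ⇒<; ≡ᵇ⇒≡; ≡⇒≡ᵇ)
  open import Data.Bool using (true; false; T)
  open import Data.Bool.Properties using (T-≡; T-∧)
  open import Data.List using (List; []; _∷_; length; map; zip; downFrom)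
  open import Data.List.Properties using (length-downFrom)
  open import Data.List.Membership.Propositional using (_∈_; find; lose)
  open import Data.List.Membership.Propositional.Properties
    using (∈-++⁻; ∈-++⁺ˡ; ∈-++⁺ʳ; ∈-map⁺; ∈-map⁻)
  open import Data.List.Relation.Unary.All as All using (All; []; _∷_)
  open import Data.List.Relation.Unary.All.Properties using (all⁺; all⁻)
  open import Data.List.Relation.Unary.Any using (here)
  open import Data.List.Relation.Unary.Any.Properties using (any⁺; any⁻)
  open import Data.List.Relation.Unary.AllPairs using (AllPairs; []; _∷_)
  open import Data.List.Relation.Binary.Sublist.Propositional using (_⊆_; []; _∷_; _∷ʳ_)
  open import Data.Product using (∃; ∃₂; _×_; _,_; proj₁)
  open import Data.Sum using (inj₁; inj₂)
  open import Function using (_⇔_; mk⇔; _∘_)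
  open import Function.Bundles using (module Equivalence)
  open import Relation.Nullary using (¬_)
  open import Relation.Nullary.Decidable using (toWitness; fromWitness)
  open import Data.Empty using (⊥-elim)
  open import Relation.Binary.PropositionalEquality using (_≡_; refl; sym; trans; cong; subst)

  subseqs⁻ : ∀ k w {s} → s ∈ subseqs k w → s ⊆ w × length s ≡ k
  subseqs⁻ zero    []      (here refl) = [] , refl
  subseqs⁻ zero    (x ∷ w) (here refl) = x ∷ʳ proj₁ (subseqs⁻ zero w (here refl)) , refl
  subseqs⁻ (suc k) (x ∷ w) s∈ with ∈-++⁻ (map (x ∷_) (subseqs k w)) s∈
  ... | inj₂ s∈′ = let s⊆w , len = subseqs⁻ (suc k) w s∈′ in x ∷ʳ s⊆w , len
  ... | inj₁ s∈′ with ∈-map⁻ (x ∷_) s∈′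
  ...   | s′ , s′∈ , refl = let s′⊆w , len = subseqs⁻ k w s′∈ in refl ∷ s′⊆w , cong suc len

  subseqs⁺ : ∀ {s w} → s ⊆ w → s ∈ subseqs (length s) w
  subseqs⁺ []                   = here refl
  subseqs⁺ {[]}    (y ∷ʳ s⊆w)   = here refl
  subseqs⁺ {_ ∷ s} (y ∷ʳ s⊆w)   = ∈-++⁺ʳ (map (y ∷_) (subseqs (length s) _)) (subseqs⁺ s⊆w)
  subseqs⁺         (refl ∷ s⊆w) = ∈-++⁺ˡ (∈-map⁺ _ (subseqs⁺ s⊆w))

  contains⇔ : ∀ w τ → T (contains w τ) ⇔ (∃ λ s → s ⊆ w × T (orderIso τ s))
  contains⇔ w τ = mk⇔ to from
    where
    to : T (contains w τ) → ∃ λ s → s ⊆ w × T (orderIso τ s)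
    to c with find (any⁻ (orderIso τ) (subseqs (length τ) w) c)
    ... | s , s∈ , iso = s , proj₁ (subseqs⁻ (length τ) w s∈) , iso
    from : (∃ λ s → s ⊆ w × T (orderIso τ s)) → T (contains w τ)
    from (s , s⊆w , iso) =
      any⁺ (orderIso τ) (lose (subst (λ k → s ∈ subseqs k w) (length-orderIso τ s iso) (subseqs⁺ s⊆w)) iso)
      where
      length-orderIso : ∀ τ s → T (orderIso τ s) → length s ≡ length τ
      length-orderIso τ s iso = sym (≡ᵇ⇒≡ _ _ (proj₁ (Equivalence.to T-∧ iso)))

  <ᵇ-true : ∀ {m n} → m < n → (m <ᵇ n) ≡ true
  <ᵇ-true = Equivalence.to T-≡ ∘ <⇒<ᵇ

  <ᵇ-false : ∀ {m n} → n ≤ m → (m <ᵇ n) ≡ false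
  <ᵇ-false {n = zero}  _         = refl
  <ᵇ-false {n = suc n} (s≤s n≤m) = <ᵇ-false n≤m

  true-<ᵇ : ∀ {m n} → true ≡ (m <ᵇ n) → m < n
  true-<ᵇ t = <ᵇ⇒< _ _ (Equivalence.from T-≡ (sym t))

  SameOrder : ℕ × ℕ → ℕ × ℕ → Set
  SameOrder (a , b) (c , d) = (a <ᵇ c) ≡ (b <ᵇ d)

  Coherent : List (ℕ × ℕ) → Set
  Coherent zs = All (λ p → All (SameOrder p) zs) zs

  orderIso⇔ : ∀ xs ys → T (orderIso xs ys) ⇔ (length xs ≡ length ys × Coherent (zip xs ys))
  orderIso⇔ xs ys = mk⇔ to from
    where
    zs = zip xs ys
    to : T (orderIso xs ys) → length xs ≡ length ys × Coherent zs
    to iso with len , coh ← Equivalence.to T-∧ iso =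
      ≡ᵇ⇒≡ _ _ len , All.map (All.map toWitness ∘ all⁺ _ zs) (all⁺ _ zs coh)
    from : length xs ≡ length ys × Coherent zs → T (orderIso xs ys)
    from (len , coh) = Equivalence.from T-∧
      (≡⇒≡ᵇ _ _ len , all⁻ _ (All.map (all⁻ _ ∘ All.map fromWitness) coh))

  Coherent-∷ : ∀ z zs → Coherent (z ∷ zs) ⇔ (All (λ q → SameOrder z q × SameOrder q z) zs × Coherent zs)
  Coherent-∷ z zs = mk⇔ to from
    where
    to : Coherent (z ∷ zs) → All (λ q → SameOrder z q × SameOrder q z) zs × Coherent zs
    to ((_ ∷ zq) ∷ rest) = All.zip (zq , All.map All.head rest) , All.map All.tail rest
    from : All (λ q → SameOrder z q × SameOrder q z) zs × Coherent zs → Coherent (z ∷ zs)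
    from (both , coh) =
      (self z ∷ All.map proj₁ both) ∷ All.zipWith (λ ((_ , qz) , q*) → qz ∷ q*) (both , coh)
      where
      self : ∀ p → SameOrder p p
      self (a , b) = trans (<ᵇ-false {a} ℕ.≤-refl) (sym (<ᵇ-false {b} ℕ.≤-refl))

  Decreasing : List ℕ → Set
  Decreasing = AllPairs _>_

  HasDecreasing : ℕ → List ℕ → Set
  HasDecreasing k w = ∃ λ s → s ⊆ w × length s ≡ k × Decreasing s

  All-zip-downFrom⇔ : ∀ {P : ℕ × ℕ → Set} {Q : ℕ → Set} s →
                      (∀ {j b} → j < length s → P (j , b) ⇔ Q b) →
                      All P (zip (downFrom (length s)) s) ⇔ All Q s
  All-zip-downFrom⇔ []      P⇔Q = mk⇔ (λ _ → []) (λ _ → [])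
  All-zip-downFrom⇔ (b ∷ s) P⇔Q = mk⇔
    (λ { (p ∷ ps) → Equivalence.to (P⇔Q ℕ.≤-refl) p ∷ Equivalence.to rest ps })
    (λ { (q ∷ qs) → Equivalence.from (P⇔Q ℕ.≤-refl) q ∷ Equivalence.from rest qs })
    where rest = All-zip-downFrom⇔ s (P⇔Q ∘ ℕ.m<n⇒m<1+n)

  Coherent-downFrom⇔ : ∀ s → Coherent (zip (downFrom (length s)) s) ⇔ Decreasing s
  Coherent-downFrom⇔ []      = mk⇔ (λ _ → []) (λ _ → [])
  Coherent-downFrom⇔ (a ∷ s) = mk⇔
    (λ coh → let below , coh′ = Equivalence.to (Coherent-∷ _ _) coh
             in Equivalence.to smaller below ∷ Equivalence.to (Coherent-downFrom⇔ s) coh′)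
    (λ { (below ∷ desc) → Equivalence.from (Coherent-∷ _ _)
           (Equivalence.from smaller below , Equivalence.from (Coherent-downFrom⇔ s) desc) })
    where
    m = length s
    smaller : All (λ q → SameOrder (m , a) q × SameOrder q (m , a)) (zip (downFrom m) s) ⇔ All (a >_) s
    smaller = All-zip-downFrom⇔ s λ {j} {b} j<m → mk⇔
      (λ (_ , ba) → true-<ᵇ (trans (sym (<ᵇ-true j<m)) ba))
      (λ b<a → trans (<ᵇ-false (ℕ.<⇒≤ j<m)) (sym (<ᵇ-false (ℕ.<⇒≤ b<a)))
             , trans (<ᵇ-true j<m) (sym (<ᵇ-true b<a)))

  orderIso-dec⇔ : ∀ k s → T (orderIso (dec k) s) ⇔ (length s ≡ k × Decreasing s)
  orderIso-dec⇔ k s = mk⇔ to from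
    where
    to : T (orderIso (dec k) s) → length s ≡ k × Decreasing s
    to iso with len , coh ← Equivalence.to (orderIso⇔ (dec k) s) iso
            with refl ← trans (sym len) (length-downFrom k) =
      refl , Equivalence.to (Coherent-downFrom⇔ s) coh
    from : length s ≡ k × Decreasing s → T (orderIso (dec k) s)
    from (refl , desc) = Equivalence.from (orderIso⇔ (dec (length s)) s)
      (length-downFrom (length s) , Equivalence.from (Coherent-downFrom⇔ s) desc)

  contains-dec⇔ : ∀ w k → T (contains w (dec k)) ⇔ HasDecreasing k w
  contains-dec⇔ w k = mk⇔
    (λ c → let s , s⊆w , iso = Equivalence.to (contains⇔ w (dec k)) c
               len , desc = Equivalence.to (orderIso-dec⇔ k s) iso
           in s , s⊆w , len , desc)
    (λ (s , s⊆w , len , desc) →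
       Equivalence.from (contains⇔ w (dec k)) (s , s⊆w , Equivalence.from (orderIso-dec⇔ k s) (len , desc)))

  Has132 : List ℕ → Set
  Has132 w = ∃₂ λ a b → ∃ λ c → (a ∷ b ∷ c ∷ []) ⊆ w × a < c × c < b

  contains-132⇔ : ∀ w → T (contains w p132) ⇔ Has132 w
  contains-132⇔ w = mk⇔ to from
    where
    to : T (contains w p132) → Has132 w
    to c with s , s⊆w , iso ← Equivalence.to (contains⇔ w p132) c =
      occurrence s s⊆w (Equivalence.to (orderIso⇔ p132 s) iso)
      where
      occurrence : ∀ s → s ⊆ w → length p132 ≡ length s × Coherent (zip p132 s) → Has132 w
      occurrence (a ∷ b ∷ c ∷ []) s⊆w (refl , coh) with Equivalence.to (Coherent-∷ _ _) coh
      ... | (_ ∷ (a<ᵇc , _) ∷ []) , coh′ with Equivalence.to (Coherent-∷ _ _) coh′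
      ...   | ((_ , c<ᵇb) ∷ []) , _ = a , b , c , s⊆w , true-<ᵇ a<ᵇc , true-<ᵇ c<ᵇb
    from : Has132 w → T (contains w p132)
    from (a , b , c , s⊆w , a<c , c<b) = Equivalence.from (contains⇔ w p132) (_ , s⊆w ,
      Equivalence.from (orderIso⇔ p132 (a ∷ b ∷ c ∷ [])) (refl , Equivalence.from (Coherent-∷ _ _)
        -- the pairs of positions of 1 3 2 say a < b, a < c and c < b
        ( (sym (<ᵇ-true a<b) , sym (<ᵇ-false (ℕ.<⇒≤ a<b)))
        ∷ (sym (<ᵇ-true a<c) , sym (<ᵇ-false (ℕ.<⇒≤ a<c))) ∷ []
        , Equivalence.from (Coherent-∷ _ _)
            ((sym (<ᵇ-false (ℕ.<⇒≤ c<b)) , sym (<ᵇ-true c<b)) ∷ []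
            , Equivalence.from (Coherent-∷ _ _) ([] , [])))))
      where a<b = ℕ.<-trans a<c c<b

  avoids-132⇔ : ∀ w → avoids w p132 ≡ true ⇔ (¬ Has132 w)
  avoids-132⇔ w with contains w p132 in eq
  ... | true  = mk⇔ (λ ())
    (λ ¬has → ⊥-elim (¬has (Equivalence.to (contains-132⇔ w) (Equivalence.from T-≡ eq))))
  ... | false = mk⇔ (λ _ has → subst T eq (Equivalence.from (contains-132⇔ w) has)) (λ _ → refl)


module LongestDecreasing where

  open import Data.Nat using (ℕ; zero; suc; _≤_; _<ᵇ_; _+_)
  import Data.Nat.Properties as ℕ
  open import Data.Bool using (true; false; T; if_then_else_)
  open import Data.Bool.Properties using (T-≡)
  open import Data.List using (List; []; _∷_; [_]; length; map; take)
  open import Data.List.Properties using (length-map; length-take)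
  open import Data.List.Relation.Unary.All using ([]; _∷_)
  open import Data.List.Relation.Unary.AllPairs as AllPairs using ([]; _∷_)
  import Data.List.Relation.Unary.AllPairs.Properties as AllPairs
  open import Data.List.Relation.Binary.Sublist.Propositional
    using (_⊆_; []; _∷_; minimum; ⊆-trans)
  open import Data.List.Relation.Binary.Sublist.Propositional.Properties
    using (length-mono-≤; map⁺; take-⊆)
  open import Data.Product using (_×_; _,_; proj₁; proj₂)
  open import Data.Sum using (inj₁; inj₂)
  open import Data.Empty using (⊥-elim)
  open import Function using (_⇔_; mk⇔)
  open import Function.Bundles using (module Equivalence)
  open import Relation.Nullary using (¬_)
  open import Relation.Binary.PropositionalEquality using (_≡_; refl; sym; trans; subst)
  open Patterns
  open Sublists

  HasDecreasing-≤ : ∀ {k j w} → k ≤ j → HasDecreasing j w → HasDecreasing k w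
  HasDecreasing-≤ {k} k≤j (s , s⊆w , refl , desc) =
    take k s , ⊆-trans (take-⊆ k s) s⊆w , trans (length-take k s) (ℕ.m≤n⇒m⊓n≡m k≤j) ,
    AllPairs.take⁺ k desc

  HasDecreasing-length : ∀ {k w} → HasDecreasing k w → k ≤ length w
  HasDecreasing-length (s , s⊆w , refl , _) = length-mono-≤ s⊆w

  ldsUpTo : List ℕ → ℕ → ℕ
  ldsUpTo w zero    = zero
  ldsUpTo w (suc m) = if contains w (dec (suc m)) then suc m else ldsUpTo w m

  lds : List ℕ → ℕ
  lds w = ldsUpTo w (length w)

  lds-longest : ∀ w → HasDecreasing (lds w) w × ¬ HasDecreasing (suc (lds w)) w
  lds-longest w = search (length w) (λ has → ℕ.<-irrefl refl (HasDecreasing-length has))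
    where
    search : ∀ m → ¬ HasDecreasing (suc m) w →
             HasDecreasing (ldsUpTo w m) w × ¬ HasDecreasing (suc (ldsUpTo w m)) w
    search zero    none = ([] , minimum w , refl , []) , none
    search (suc m) none with contains w (dec (suc m)) in found
    ... | true  = Equivalence.to (contains-dec⇔ w (suc m)) (Equivalence.from T-≡ found) , none
    ... | false = search m λ has → subst T found (Equivalence.from (contains-dec⇔ w (suc m)) has)

  HasDecreasing⇔≤lds : ∀ {k w} → HasDecreasing k w ⇔ k ≤ lds w
  HasDecreasing⇔≤lds {k} {w} = mk⇔
    (λ has → ℕ.≮⇒≥ λ lds<k → proj₂ (lds-longest w) (HasDecreasing-≤ lds<k has))
    (λ k≤lds → HasDecreasing-≤ k≤lds (proj₁ (lds-longest w)))

  lds-nonempty : ∀ x w → 1 ≤ lds (x ∷ w)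
  lds-nonempty x w = Equivalence.to HasDecreasing⇔≤lds ([ x ] , refl ∷ minimum w , refl , [] ∷ [])

  avoids-dec : ∀ w k → avoids w (dec k) ≡ (lds w <ᵇ k)
  avoids-dec w k with contains w (dec k) in found
  ... | true  = sym (<ᵇ-false (Equivalence.to HasDecreasing⇔≤lds
                     (Equivalence.to (contains-dec⇔ w k) (Equivalence.from T-≡ found))))
  ... | false with ℕ.<-≤-connex (lds w) k
  ...   | inj₁ lds<k = sym (<ᵇ-true lds<k)
  ...   | inj₂ k≤lds = ⊥-elim (subst T found (Equivalence.from (contains-dec⇔ w k)
                         (Equivalence.from HasDecreasing⇔≤lds k≤lds)))

  raise : ℕ → List ℕ → List ℕ
  raise c = map (_+ c)

  Decreasing-raise⇔ : ∀ c s → Decreasing (raise c s) ⇔ Decreasing s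
  Decreasing-raise⇔ c s = mk⇔
    (λ desc → AllPairs.map (ℕ.+-cancelʳ-< c _ _) (AllPairs.map⁻ desc))
    (λ desc → AllPairs.map⁺ (AllPairs.map (ℕ.+-monoˡ-< c) desc))

  HasDecreasing-raise⇔ : ∀ c {k} w → HasDecreasing k (raise c w) ⇔ HasDecreasing k w
  HasDecreasing-raise⇔ c w = mk⇔
    (λ (s , s⊆ , len , desc) → let s′ , eq , s′⊆ = ⊆-map⁻ (_+ c) w s⊆ in
       s′ , s′⊆ , trans (sym (length-map (_+ c) s′)) (subst (λ t → length t ≡ _) eq len) ,
       Equivalence.to (Decreasing-raise⇔ c s′) (subst Decreasing eq desc))
    (λ (s , s⊆ , len , desc) →
       raise c s , map⁺ (_+ c) s⊆ , trans (length-map (_+ c) s) len , Equivalence.from (Decreasing-raise⇔ c s) desc)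

  lds-raise : ∀ c w → lds (raise c w) ≡ lds w
  lds-raise c w = ℕ.≤-antisym
    (Equivalence.to HasDecreasing⇔≤lds (Equivalence.to (HasDecreasing-raise⇔ c w) (proj₁ (lds-longest (raise c w)))))
    (Equivalence.to HasDecreasing⇔≤lds (Equivalence.from (HasDecreasing-raise⇔ c w) (proj₁ (lds-longest w))))


module Separation where

  open import Data.Nat using (ℕ; suc; _+_; _<_; _≤_; _⊔_; s≤s)
  import Data.Nat.Properties as ℕ
  open import Data.List using (List; []; _∷_; length; _++_)
  open import Data.List.Properties using (length-++)
  open import Data.List.Membership.Propositional using (_∈_)
  open import Data.List.Membership.Propositional.Properties using (∈-++⁺ʳ)
  open import Data.List.Relation.Unary.All as All using (All; []; _∷_)
  open import Data.List.Relation.Unary.Any using (here)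
  open import Data.List.Relation.Unary.AllPairs using (_∷_)
  import Data.List.Relation.Unary.AllPairs.Properties as AllPairs
  open import Data.List.Relation.Binary.Sublist.Propositional using (_⊆_; _∷_; _∷ʳ_; from∈; ⊆-refl)
  open import Data.List.Relation.Binary.Sublist.Propositional.Properties
    using (++⁺; ++⁺ˡ; ++⁺ʳ; All-resp-⊆; map⁺)
  open import Data.Product using (∃; _×_; _,_; proj₁)
  open import Data.Sum using (_⊎_; inj₁; inj₂)
  open import Data.Empty using (⊥-elim)
  open import Function using (_⇔_; mk⇔)
  open import Function.Bundles using (module Equivalence)
  open import Relation.Binary.PropositionalEquality using (_≡_; refl; sym; trans; cong; cong₂; subst)
  open Sublists
  open Patterns
  open LongestDecreasing

  Has132-raise⇔ : ∀ c w → Has132 (raise c w) ⇔ Has132 w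
  Has132-raise⇔ c w = mk⇔
    (λ (a , b , d , s⊆ , a<d , d<b) → case⊆ (⊆-map⁻ (_+ c) w s⊆) a<d d<b)
    (λ (a , b , d , s⊆ , a<d , d<b) →
       a + c , b + c , d + c , map⁺ (_+ c) s⊆ , ℕ.+-monoˡ-< c a<d , ℕ.+-monoˡ-< c d<b)
    where
    case⊆ : ∀ {a b d} → (∃ λ s′ → a ∷ b ∷ d ∷ [] ≡ raise c s′ × s′ ⊆ w) →
            a < d → d < b → Has132 w
    case⊆ (a′ ∷ b′ ∷ d′ ∷ [] , refl , s′⊆) a<d d<b =
      a′ , b′ , d′ , s′⊆ , ℕ.+-cancelʳ-< c a′ d′ a<d , ℕ.+-cancelʳ-< c d′ b′ d<b

  record Separated (U : List ℕ) (m : ℕ) (v : List ℕ) : Set where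
    constructor mkSeparated
    field
      left>right : All (λ u → All (_< u) v) U
      left<max   : All (_< m) U
      right<max  : All (_< m) v

  module _ {U m v} (sep : Separated U m v) where
    open Separated sep

    HasDecreasing-split : ∀ {k} → HasDecreasing k (U ++ m ∷ v) → k ≤ (lds U + lds v) ⊔ suc (lds v)
    HasDecreasing-split (s , s⊆ , refl , desc) with s₁ , s₂ , refl , s₁⊆U , s₂⊆ ← ⊆-++-split U s⊆ =
      subst (_≤ _) (sym (length-++ s₁)) (bound s₁ s₂ s₁⊆U s₂⊆ desc)
      where
      longest : ∀ {s w} → s ⊆ w → Decreasing s → length s ≤ lds w
      longest s⊆w desc = Equivalence.to HasDecreasing⇔≤lds (_ , s⊆w , refl , desc)
      bound : ∀ s₁ s₂ → s₁ ⊆ U → s₂ ⊆ m ∷ v → Decreasing (s₁ ++ s₂) →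
              length s₁ + length s₂ ≤ (lds U + lds v) ⊔ suc (lds v)
      bound s₁ s₂ s₁⊆U (_ ∷ʳ s₂⊆v) desc = ℕ.≤-trans
        (ℕ.+-mono-≤ (longest s₁⊆U (AllPairs-resp-⊇ (++⁺ʳ s₂ ⊆-refl) desc))
                    (longest s₂⊆v (AllPairs-resp-⊇ (++⁺ˡ s₁ ⊆-refl) desc)))
        (ℕ.m≤m⊔n _ _)
      bound [] (m ∷ s₂) s₁⊆U (refl ∷ s₂⊆v) (_ ∷ desc) =
        ℕ.≤-trans (s≤s (longest s₂⊆v desc)) (ℕ.m≤n⊔m _ _)
      bound (a ∷ s₁) (m ∷ s₂) s₁⊆U (refl ∷ s₂⊆v) (a> ∷ _)
        with a<m ∷ _ ← All-resp-⊆ s₁⊆U left<max =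
        ⊥-elim (ℕ.<-asym a<m (All.lookup a> (∈-++⁺ʳ s₁ (here refl))))

    lds-split : lds (U ++ m ∷ v) ≡ (lds U + lds v) ⊔ suc (lds v)
    lds-split with sU , sU⊆ , lenU , descU ← proj₁ (lds-longest U)
                  | sv , sv⊆ , lenv , descv ← proj₁ (lds-longest v) = ℕ.≤-antisym
      (HasDecreasing-split (proj₁ (lds-longest (U ++ m ∷ v))))
      (ℕ.⊔-lub (Equivalence.to HasDecreasing⇔≤lds
                  (sU ++ sv , ++⁺ sU⊆ (m ∷ʳ sv⊆) , trans (length-++ sU) (cong₂ _+_ lenU lenv) ,
                   AllPairs.++⁺ descU descv (All.map (All-resp-⊆ sv⊆) (All-resp-⊆ sU⊆ left>right))))
               (Equivalence.to HasDecreasing⇔≤lds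
                  (m ∷ sv , ++⁺ˡ U (refl ∷ sv⊆) , cong suc lenv , All-resp-⊆ sv⊆ right<max ∷ descv)))

    Has132-split : Has132 (U ++ m ∷ v) → Has132 U ⊎ Has132 v
    Has132-split (a , b , c , s⊆ , a<c , c<b) with s₁ , s₂ , eq , s₁⊆U , s₂⊆ ← ⊆-++-split U s⊆ =
      cases s₁ s₂ eq s₁⊆U s₂⊆
      where
      cases : ∀ s₁ s₂ → a ∷ b ∷ c ∷ [] ≡ s₁ ++ s₂ → s₁ ⊆ U → s₂ ⊆ m ∷ v →
              Has132 U ⊎ Has132 v
      cases [] _ refl _ (_ ∷ʳ s⊆v) = inj₂ (a , b , c , s⊆v , a<c , c<b)
      cases [] _ refl _ (refl ∷ s⊆v) with _ ∷ c<m ∷ [] ← All-resp-⊆ s⊆v right<max =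
        ⊥-elim (ℕ.<-asym c<m a<c)
      cases (_ ∷ []) _ refl s₁⊆U s₂⊆ with c<a ∷ [] ← All-resp-⊆ s₁⊆U left>right =
        ⊥-elim (ℕ.<-asym a<c (c<a′ s₂⊆))
        where
        c<a′ : b ∷ c ∷ [] ⊆ m ∷ v → c < a
        c<a′ (_ ∷ʳ s⊆v)   with _ ∷ c<a ∷ [] ← All-resp-⊆ s⊆v c<a = c<a
        c<a′ (refl ∷ s⊆v) with c<a ∷ [] ← All-resp-⊆ s⊆v c<a = c<a
      cases (_ ∷ _ ∷ []) _ refl s₁⊆U (_ ∷ʳ s⊆v)
        with c<a ∷ _ ← All-resp-⊆ s₁⊆U left>right
        with c<a′ ∷ [] ← All-resp-⊆ s⊆v c<a = ⊥-elim (ℕ.<-asym a<c c<a′)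
      cases (_ ∷ _ ∷ []) _ refl s₁⊆U (refl ∷ _) with _ ∷ b<m ∷ [] ← All-resp-⊆ s₁⊆U left<max =
        ⊥-elim (ℕ.<-asym b<m c<b)
      cases (_ ∷ _ ∷ _ ∷ []) [] refl s₁⊆U _ = inj₁ (a , b , c , s₁⊆U , a<c , c<b)

  Has132-++ˡ : ∀ {U} ys → Has132 U → Has132 (U ++ ys)
  Has132-++ˡ ys (a , b , c , s⊆ , a<c , c<b) = a , b , c , ++⁺ʳ ys s⊆ , a<c , c<b

  Has132-++ʳ : ∀ U {v} m → Has132 v → Has132 (U ++ m ∷ v)
  Has132-++ʳ U m (a , b , c , s⊆ , a<c , c<b) = a , b , c , ++⁺ˡ U (m ∷ʳ s⊆) , a<c , c<b

  Has132-across : ∀ U {m v u x} → u ∈ U → x ∈ v → u < x → x < m → Has132 (U ++ m ∷ v)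
  Has132-across U u∈U x∈v u<x x<m = _ , _ , _ , ++⁺ (from∈ u∈U) (refl ∷ from∈ x∈v) , u<x , x<m


module Permutations where

  open import Data.Nat using (ℕ; zero; suc; _<_; _≤_; _≡ᵇ_; z≤n)
  import Data.Nat.Properties as ℕ
  open import Data.Bool using (true; false; T; not)
  open import Data.Bool.Properties using (T-≡; T-∧; T-not-≡)
  open import Data.Fin using (Fin; fromℕ<)
  import Data.Fin.Properties as Fin
  open import Data.Vec using (Vec; []; _∷_)
  import Data.Vec.Properties as Vec
  open import Data.List using (List; []; _∷_; length; map; allFin)
  open import Data.List.Properties using (∷-injective)
  open import Data.List.Membership.Propositional using (_∈_; lose)
  open import Data.List.Membership.Propositional.Properties
    using (∈-map⁺; ∈-map⁻; ∈-filter⁺; ∈-filter⁻; ∈-allFin; ∈-concatMap⁺)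
  open import Data.List.Relation.Unary.All as All using (All; []; _∷_)
  open import Data.List.Relation.Unary.All.Properties using (all⁺; all⁻)
  import Data.List.Relation.Unary.All.Properties as All
  open import Data.List.Relation.Unary.Any using (here)
  open import Data.List.Relation.Unary.AllPairs as AllPairs using ([]; _∷_)
  import Data.List.Relation.Unary.AllPairs.Properties as AllPairs
  open import Data.List.Relation.Unary.Unique.Propositional using (Unique)
  import Data.List.Relation.Unary.Unique.Propositional.Properties as Unique
  open import Data.Product using (Σ; _×_; _,_; proj₁; proj₂)
  open import Data.Empty using (⊥-elim)
  open import Function using (_⇔_; mk⇔; _∘_)
  open import Function.Bundles using (module Equivalence)
  open import Relation.Nullary using (yes; no)
  open import Relation.Binary.PropositionalEquality using (_≡_; _≢_; refl; cong; cong₂; subst)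
  open import Data.List.Membership.DecPropositional ℕ._≟_ using (_∈?_)
  open UniqueLists

  IsPerm : ℕ → List ℕ → Set
  IsPerm n w = length w ≡ n × All (_< n) w × Unique w

  maximum-∈ : ∀ {m w} → IsPerm (suc m) w → m ∈ w
  maximum-∈ {m} {w} (len , w< , uw) with m ∈? w
  ... | yes m∈w = m∈w
  ... | no  m∉w = ⊥-elim (ℕ.<-irrefl refl (subst (_≤ m) len (Unique-bounded⇒length≤ uw (All.tabulate below))))
    where
    below : ∀ {y} → y ∈ w → 0 ≤ y × y < m
    below y∈w = z≤n , ℕ.≤∧≢⇒< (ℕ.≤-pred (All.lookup w< y∈w)) (λ { refl → m∉w y∈w })

  ≡ᵇ-false⇒≢ : ∀ {x y} → T (not (x ≡ᵇ y)) → x ≢ y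
  ≡ᵇ-false⇒≢ {x} x≢ᵇx refl = subst T (Equivalence.to T-not-≡ x≢ᵇx) (ℕ.≡⇒≡ᵇ x x refl)

  ≢⇒≡ᵇ-false : ∀ {x y} → x ≢ y → T (not (x ≡ᵇ y))
  ≢⇒≡ᵇ-false {x} {y} x≢y with x ≡ᵇ y in eq
  ... | true  = x≢y (ℕ.≡ᵇ⇒≡ x y (Equivalence.from T-≡ eq))
  ... | false = _

  distinct⇔Unique : ∀ w → distinct w ≡ true ⇔ Unique w
  distinct⇔Unique w = mk⇔ (to w ∘ Equivalence.from T-≡) (Equivalence.to T-≡ ∘ from w)
    where
    to : ∀ w → T (distinct w) → Unique w
    to []      _ = []
    to (x ∷ w) d with x∉ , dw ← Equivalence.to T-∧ d = All.map ≡ᵇ-false⇒≢ (all⁺ _ w x∉) ∷ to w dw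
    from : ∀ w → Unique w → T (distinct w)
    from []      _          = _
    from (x ∷ w) (x∉ ∷ uw) = Equivalence.from T-∧ (all⁻ _ (All.map ≢⇒≡ᵇ-false x∉) , from w uw)

  word-length : ∀ {m n} (v : Vec (Fin n) m) → length (word v) ≡ m
  word-length []      = refl
  word-length (i ∷ v) = cong suc (word-length v)

  word-< : ∀ {m n} (v : Vec (Fin n) m) → All (_< n) (word v)
  word-< []      = []
  word-< (i ∷ v) = Fin.toℕ<n i ∷ word-< v

  word-injective : ∀ {m n} (v v′ : Vec (Fin n) m) → word v ≡ word v′ → v ≡ v′
  word-injective []      []        _  = refl
  word-injective (i ∷ v) (i′ ∷ v′) eq with i≡ , v≡ ← ∷-injective eq =
    cong₂ _∷_ (Fin.toℕ-injective i≡) (word-injective v v′ v≡)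

  word-surjective : ∀ {n} w → All (_< n) w → Σ (Vec (Fin n) (length w)) (λ v → word v ≡ w)
  word-surjective []      []          = [] , refl
  word-surjective (x ∷ w) (x<n ∷ w<n) with v , eq ← word-surjective w w<n =
    fromℕ< x<n ∷ v , cong₂ _∷_ (Fin.toℕ-fromℕ< x<n) eq

  ∈-allVecs : ∀ {m n} (v : Vec (Fin n) m) → v ∈ allVecs m n
  ∈-allVecs []      = here refl
  ∈-allVecs (i ∷ v) = ∈-concatMap⁺ _ (lose (∈-allFin i) (∈-map⁺ (i ∷_) (∈-allVecs v)))

  allVecs-unique : ∀ m n → Unique (allVecs m n)
  allVecs-unique zero    n = [] ∷ []
  allVecs-unique (suc m) n = Unique.concat⁺
    (All.map⁺ (All.universal (λ _ → Unique.map⁺ (proj₂ ∘ Vec.∷-injective) (allVecs-unique m n)) (allFin n)))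
    (AllPairs.map⁺ (AllPairs.map (λ i≢j {v} (v∈i , v∈j) → i≢j (heads v∈i v∈j)) (Unique.allFin⁺ n)))
    where
    heads : ∀ {i j v} → v ∈ map (i ∷_) (allVecs m n) → v ∈ map (j ∷_) (allVecs m n) → i ≡ j
    heads v∈i v∈j with _ , _ , refl ← ∈-map⁻ _ v∈i | _ , _ , eq ← ∈-map⁻ _ v∈j =
      proj₁ (Vec.∷-injective eq)

  ∈-Sym⇔ : ∀ n {w} → w ∈ Sym n ⇔ IsPerm n w
  ∈-Sym⇔ n {w} = mk⇔ to from
    where
    to : w ∈ Sym n → IsPerm n w
    to w∈ with w∈words , d ← ∈-filter⁻ _ {xs = map word (allVecs n n)} w∈
          with v , _ , refl ← ∈-map⁻ word w∈words =
      word-length v , word-< v , Equivalence.to (distinct⇔Unique (word v)) d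
    from : IsPerm n w → w ∈ Sym n
    from (refl , w<n , uw) with v , eq ← word-surjective w w<n =
      ∈-filter⁺ _ (subst (_∈ _) eq (∈-map⁺ word (∈-allVecs v))) (Equivalence.from (distinct⇔Unique w) uw)

  Sym-unique : ∀ n → Unique (Sym n)
  Sym-unique n = Unique.filter⁺ _ (Unique.map⁺ (word-injective _ _) (allVecs-unique n n))


module Avoiders where

  open import Data.Nat using (ℕ; zero; suc; _+_; _∸_; _<_; _≤_; _⊔_; z≤n; s≤s)
  import Data.Nat.Properties as ℕ
  open import Data.Nat.Induction using (<-rec)
  open import Data.List using (List; []; _∷_; [_]; length; map; _++_; concatMap; cartesianProduct; upTo)
  open import Data.List.Properties
    using (length-++; length-map; map-cong-local; map-∘; map-id-local; map-injective)
  open import Data.List.Membership.Propositional using (_∈_; lose; find)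
  open import Data.List.Membership.Propositional.Properties
    using (∈-∃++; ∈-++⁺ˡ; ∈-++⁺ʳ; ∈-map⁺; ∈-map⁻; ∈-concatMap⁺; ∈-concatMap⁻;
           ∈-cartesianProduct⁺; ∈-cartesianProduct⁻; ∈-upTo⁺; ∈-upTo⁻)
  open import Data.List.Relation.Unary.All as All using (All; []; _∷_)
  import Data.List.Relation.Unary.All.Properties as All
  open import Data.List.Relation.Unary.Any using (here; there)
  open import Data.List.Relation.Unary.AllPairs as AllPairs using ([]; _∷_)
  import Data.List.Relation.Unary.AllPairs.Properties as AllPairs
  open import Data.List.Relation.Unary.Unique.Propositional using (Unique)
  import Data.List.Relation.Unary.Unique.Propositional.Properties as Unique
  open import Data.Product using (∃; _×_; _,_; proj₁; proj₂; uncurry)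
  open import Data.Sum using ([_,_]′)
  open import Data.Empty using (⊥-elim)
  open import Function using (_⇔_; mk⇔; _∘_)
  open import Function.Bundles using (module Equivalence)
  open import Relation.Nullary using (¬_)
  open import Relation.Binary.Definitions using (Tri; tri<; tri≈; tri>)
  open import Data.List.Relation.Binary.Sublist.Propositional using (_∷_; _∷ʳ_; minimum; from∈; ⊆-refl)
  open import Data.List.Relation.Binary.Sublist.Propositional.Properties using (++⁺; ++⁺ˡ; ++⁺ʳ)
  open import Relation.Binary.PropositionalEquality using (_≡_; _≢_; refl; sym; trans; cong; cong₂; subst)
  open Sublists
  open UniqueLists
  open Patterns
  open LongestDecreasing
  open Separation
  open Permutations

  Avoider : ℕ → List ℕ → Set
  Avoider n w = IsPerm n w × ¬ Has132 w

  assemble : List ℕ → List ℕ → List ℕ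
  assemble β γ = raise (length γ) β ++ (length β + length γ) ∷ γ

  assemble-separated : ∀ β γ → All (_< length β) β → All (_< length γ) γ →
                       Separated (raise (length γ) β) (length β + length γ) γ
  assemble-separated β γ β< γ< = mkSeparated
    (All.map⁺ (All.map (λ {b} _ → All.map (λ x<j → ℕ.<-≤-trans x<j (ℕ.m≤n+m _ b)) γ<) β<))
    (All.map⁺ (All.map (ℕ.+-monoˡ-< (length γ)) β<))
    (All.map (λ x<j → ℕ.<-≤-trans x<j (ℕ.m≤n+m _ (length β))) γ<)

  assemble-Avoider : ∀ {i j β γ} → Avoider i β → Avoider j γ → Avoider (suc (i + j)) (assemble β γ)
  assemble-Avoider {β = β} {γ} ((refl , β< , uβ) , β∌132) ((refl , γ< , uγ) , γ∌132) =
    ( trans (length-++ (raise (length γ) β))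
            (trans (cong (_+ suc (length γ)) (length-map _ β)) (ℕ.+-suc _ _))
    , All.++⁺ (All.map ℕ.m<n⇒m<1+n left<max) (ℕ.≤-refl ∷ All.map ℕ.m<n⇒m<1+n right<max)
    , Unique.++⁺ (Unique.map⁺ (ℕ.+-cancelʳ-≡ (length γ) _ _) uβ)
                 (All.map (λ x<m → ℕ.<⇒≢ x<m ∘ sym) right<max ∷ uγ) disjoint )
    , [ β∌132 ∘ Equivalence.to (Has132-raise⇔ (length γ) β) , γ∌132 ]′ ∘ Has132-split sep
    where
    sep : Separated (raise (length γ) β) (length β + length γ) γ
    sep = assemble-separated β γ β< γ<
    open Separated sep
    disjoint : ∀ {z} → ¬ (z ∈ raise (length γ) β × z ∈ (length β + length γ) ∷ γ)
    disjoint (z∈U , here refl)  = ℕ.<-irrefl refl (All.lookup left<max z∈U)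
    disjoint (z∈U , there z∈γ) = ℕ.<-irrefl refl (All.lookup (All.lookup left>right z∈U) z∈γ)

  lds-assemble : ∀ β γ → All (_< length β) β → All (_< length γ) γ →
                 lds (assemble β γ) ≡ (lds β + lds γ) ⊔ suc (lds γ)
  lds-assemble β γ β< γ< =
    trans (lds-split (assemble-separated β γ β< γ<))
          (cong (λ l → (l + lds γ) ⊔ suc (lds γ)) (lds-raise (length γ) β))

  lds-assemble-[] : ∀ γ → All (_< length γ) γ → lds (assemble [] γ) ≡ suc (lds γ)
  lds-assemble-[] γ γ< = trans (lds-assemble [] γ [] γ<) (ℕ.m≤n⇒m⊔n≡n (ℕ.n≤1+n (lds γ)))

  lds-assemble-∷ : ∀ x β γ → All (_< length (x ∷ β)) (x ∷ β) → All (_< length γ) γ →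
                   lds (assemble (x ∷ β) γ) ≡ lds (x ∷ β) + lds γ
  lds-assemble-∷ x β γ β< γ< =
    trans (lds-assemble (x ∷ β) γ β< γ<) (ℕ.m≥n⇒m⊔n≡m (ℕ.+-monoˡ-≤ (lds γ) (lds-nonempty x β)))

  raise-≢ : ∀ c {β} → All (_< length β) β → All (_≢ length β + c) (raise c β)
  raise-≢ c β< = All.map⁺ (All.map (λ b< → ℕ.<⇒≢ (ℕ.+-monoˡ-< c b<)) β<)

  assemble-injective : ∀ {β γ β′ γ′} → length β + length γ ≡ length β′ + length γ′ →
                       All (_< length β) β → All (_< length β′) β′ →
                       assemble β γ ≡ assemble β′ γ′ → β ≡ β′ × γ ≡ γ′
  assemble-injective {β} {γ} {β′} {γ′} same-max β< β′< eq
    with raise≡ , refl ← ++-∷-cancel (raise (length γ) β) (raise (length γ′) β′)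
                           (raise-≢ (length γ) β<)
                           (subst (λ k → All (_≢ k) (raise (length γ′) β′)) (sym same-max)
                                  (raise-≢ (length γ′) β′<))
                           (trans eq (cong (λ k → raise (length γ′) β′ ++ k ∷ γ′) (sym same-max))) =
    map-injective (ℕ.+-cancelʳ-≡ (length γ) _ _) raise≡ , refl

  pairs : (ℕ → List (List ℕ)) → ℕ → List (List ℕ × List ℕ)
  pairs g n = concatMap (λ i → cartesianProduct (g i) (g (n ∸ i))) (upTo (suc n))

  pairs-cong : ∀ {g g′} n → (∀ {i} → i ≤ n → g i ≡ g′ i) → pairs g n ≡ pairs g′ n
  pairs-cong n g≡g′ = cong Data.List.concat (map-cong-local (All.tabulate λ {i} i∈ →
    cong₂ cartesianProduct (g≡g′ (ℕ.≤-pred (∈-upTo⁻ i∈))) (g≡g′ (ℕ.m∸n≤m n i))))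

  ∈-pairs⇔ : ∀ {g n β γ} → (β , γ) ∈ pairs g n ⇔ ∃ λ i → i ≤ n × β ∈ g i × γ ∈ g (n ∸ i)
  ∈-pairs⇔ {g} {n} = mk⇔
    (λ p∈ → let i , i∈ , p∈i = find (∈-concatMap⁻ _ p∈)
                β∈ , γ∈ = ∈-cartesianProduct⁻ (g i) _ p∈i
            in i , ℕ.≤-pred (∈-upTo⁻ i∈) , β∈ , γ∈)
    (λ (i , i≤n , β∈ , γ∈) →
       ∈-concatMap⁺ _ (lose (∈-upTo⁺ (s≤s i≤n)) (∈-cartesianProduct⁺ β∈ γ∈)))

  -- The fuel f ≥ n only serves to make the course-of-values recursion structural.
  avoidersWithin : ℕ → ℕ → List (List ℕ)
  avoidersWithin _       zero    = [ [] ]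
  avoidersWithin zero    (suc n) = []
  avoidersWithin (suc f) (suc n) = map (uncurry assemble) (pairs (avoidersWithin f) n)

  avoiders : ℕ → List (List ℕ)
  avoiders n = avoidersWithin n n

  avoidersWithin-stable : ∀ {f f′ n} → n ≤ f → n ≤ f′ → avoidersWithin f n ≡ avoidersWithin f′ n
  avoidersWithin-stable {n = zero} _ _ = refl
  avoidersWithin-stable {suc f} {suc f′} {suc n} (s≤s n≤f) (s≤s n≤f′) = cong (map (uncurry assemble))
    (pairs-cong n λ i≤n → avoidersWithin-stable (ℕ.≤-trans i≤n n≤f) (ℕ.≤-trans i≤n n≤f′))

  avoiders-suc : ∀ n → avoiders (suc n) ≡ map (uncurry assemble) (pairs avoiders n)
  avoiders-suc n = cong (map (uncurry assemble)) (pairs-cong n λ i≤n → avoidersWithin-stable i≤n ℕ.≤-refl)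

  ∈-avoiders⁻ : ∀ n {w} → w ∈ avoiders n → Avoider n w
  ∈-avoiders⁻ = <-rec _ step
    where
    step : ∀ n → (∀ {m} → m < n → ∀ {w} → w ∈ avoiders m → Avoider m w) →
           ∀ {w} → w ∈ avoiders n → Avoider n w
    step zero    _   (here refl) = (refl , [] , []) , λ ()
    step (suc n) rec w∈
      with (β , γ) , p∈ , refl ← ∈-map⁻ _ (subst (_ ∈_) (avoiders-suc n) w∈)
      with i , i≤n , β∈ , γ∈ ← Equivalence.to ∈-pairs⇔ p∈ =
      subst (λ k → Avoider (suc k) _) (ℕ.m+[n∸m]≡n i≤n)
            (assemble-Avoider (rec (s≤s i≤n) β∈) (rec (s≤s (ℕ.m∸n≤m n i)) γ∈))

  module SplitAtMaximum {m U v} (av : Avoider (suc m) (U ++ m ∷ v)) where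

    private
      len : length (U ++ m ∷ v) ≡ suc m
      len = proj₁ (proj₁ av)
      w< : All (_< suc m) (U ++ m ∷ v)
      w< = proj₁ (proj₂ (proj₁ av))
      uw : Unique (U ++ m ∷ v)
      uw = proj₂ (proj₂ (proj₁ av))
      w∌132 : ¬ Has132 (U ++ m ∷ v)
      w∌132 = proj₂ av

    lengths : length U + length v ≡ m
    lengths = ℕ.suc-injective (trans (sym (ℕ.+-suc (length U) (length v))) (trans (sym (length-++ U)) len))

    separated : Separated U m v
    separated = mkSeparated (All.tabulate U>v) (All.tabulate U<m) (All.tabulate v<m)
      where
      below-max : ∀ {x} → x ∈ U ++ m ∷ v → x ≢ m → x < m
      below-max x∈w = ℕ.≤∧≢⇒< (ℕ.≤-pred (All.lookup w< x∈w))
      U<m : ∀ {u} → u ∈ U → u < m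
      U<m u∈U = below-max (∈-++⁺ˡ u∈U) (Unique⇒≢ uw (++⁺ (from∈ u∈U) (refl ∷ minimum v)))
      v<m : ∀ {x} → x ∈ v → x < m
      v<m x∈v = below-max (∈-++⁺ʳ U (there x∈v)) (Unique⇒≢ uw (++⁺ˡ U (refl ∷ from∈ x∈v)) ∘ sym)
      U>v : ∀ {u} → u ∈ U → All (_< u) v
      U>v {u} u∈U = All.tabulate λ {x} x∈v → compare x∈v (ℕ.<-cmp x u)
        where
        compare : ∀ {x} → x ∈ v → Tri (x < u) (x ≡ u) (u < x) → x < u
        compare _   (tri< x<u _ _)  = x<u
        compare x∈v (tri≈ _ refl _) = ⊥-elim (Unique⇒≢ uw (++⁺ (from∈ u∈U) (m ∷ʳ from∈ x∈v)) refl)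
        compare x∈v (tri> _ _ u<x)  = ⊥-elim (w∌132 (Has132-across U u∈U x∈v u<x (v<m x∈v)))

    open Separated separated

    private
      uU : Unique U
      uU = AllPairs-resp-⊇ (++⁺ʳ (m ∷ v) ⊆-refl) uw
      uv : Unique v
      uv = AllPairs-resp-⊇ (++⁺ˡ U (m ∷ʳ ⊆-refl)) uw

    -- Pigeonhole: for x ∈ v the distinct entries of U lie strictly between x and m, and
    -- for u ∈ U the distinct entries of v lie below u.
    v<length : All (_< length v) v
    v<length = All.tabulate λ {x} x∈v →
      ℕ.+-cancelˡ-≤ (length U) _ _ (subst (length U + suc x ≤_) (sym lengths)
        (ℕ.m≤o∸n⇒m+n≤o (length U) (All.lookup right<max x∈v) (Unique-bounded⇒length≤ uU
          (All.zipWith (λ (u>v , u<m) → All.lookup u>v x∈v , u<m) (left>right , left<max)))))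

    length≤U : All (length v ≤_) U
    length≤U = All.map (λ u>v → Unique-bounded⇒length≤ uv (All.map (z≤n ,_) u>v)) left>right

    lowered : List ℕ
    lowered = map (_∸ length v) U

    raise-lowered : raise (length v) lowered ≡ U
    raise-lowered = trans (sym (map-∘ U)) (map-id-local (All.map ℕ.m∸n+n≡m length≤U))

    lowered-Avoider : Avoider (length U) lowered
    lowered-Avoider =
      ( length-map _ U
      , All.map (λ {u} u<m → ℕ.+-cancelʳ-< (length v) u (length U) (subst (_ <_) (sym lengths) u<m))
                (All.map⁻ (subst (All (_< m)) (sym raise-lowered) left<max))
      , Unique.map⁻ (subst Unique (sym raise-lowered) uU) )
      , w∌132 ∘ Has132-++ˡ (m ∷ v) ∘ subst Has132 raise-lowered
              ∘ Equivalence.from (Has132-raise⇔ (length v) lowered)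

    right-Avoider : Avoider (length v) v
    right-Avoider = (refl , v<length , uv) , w∌132 ∘ Has132-++ʳ U m

    assemble-lowered : assemble lowered v ≡ U ++ m ∷ v
    assemble-lowered = cong₂ _++_ raise-lowered (cong (_∷ v) (trans (cong (_+ length v) (length-map _ U)) lengths))

  ∈-avoiders⁺ : ∀ n {w} → Avoider n w → w ∈ avoiders n
  ∈-avoiders⁺ = <-rec _ step
    where
    step : ∀ n → (∀ {m} → m < n → ∀ {w} → Avoider m w → w ∈ avoiders m) →
           ∀ {w} → Avoider n w → w ∈ avoiders n
    step zero    _   {[]}    _                = here refl
    step (suc m) rec {w} av@(perm , _) with U , v , refl ← ∈-∃++ (maximum-∈ perm) =
      subst (U ++ m ∷ v ∈_) (sym (avoiders-suc m)) (subst (_∈ _) assemble-lowered (∈-map⁺ (uncurry assemble)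
        (Equivalence.from (∈-pairs⇔ {avoiders}) (length U , U≤m , rec (s≤s U≤m) lowered-Avoider ,
          subst (λ k → v ∈ avoiders k) (sym v-length) (rec (s≤s v≤m) right-Avoider)))))
      where
      open SplitAtMaximum av
      U≤m = subst (length U ≤_) lengths (ℕ.m≤m+n (length U) (length v))
      v≤m = subst (length v ≤_) lengths (ℕ.m≤n+m (length v) (length U))
      v-length : m ∸ length U ≡ length v
      v-length = trans (cong (_∸ length U) (sym lengths)) (ℕ.m+n∸m≡n (length U) (length v))

  pairs-unique : ∀ n → (∀ {i} → i ≤ n → Unique (avoiders i)) → Unique (pairs avoiders n)
  pairs-unique n unique = Unique.concat⁺
    (All.map⁺ (All.tabulate λ {i} i∈ →
      Unique.cartesianProduct⁺ (unique (ℕ.≤-pred (∈-upTo⁻ i∈))) (unique (ℕ.m∸n≤m n i))))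
    (AllPairs.map⁺ (AllPairs.map (λ i≢j {p} (p∈i , p∈j) → i≢j (blocks p∈i p∈j)) (Unique.upTo⁺ (suc n))))
    where
    blocks : ∀ {i j p} → p ∈ cartesianProduct (avoiders i) _ → p ∈ cartesianProduct (avoiders j) _ → i ≡ j
    blocks {i} {j} p∈i p∈j = trans (sym (length-of i p∈i)) (length-of j p∈j)
      where
      length-of : ∀ k {p} → p ∈ cartesianProduct (avoiders k) _ → length (proj₁ p) ≡ k
      length-of k p∈ = proj₁ (proj₁ (∈-avoiders⁻ k (proj₁ (∈-cartesianProduct⁻ _ _ p∈))))

  avoiders-unique : ∀ n → Unique (avoiders n)
  avoiders-unique = <-rec _ step
    where
    step : ∀ n → (∀ {m} → m < n → Unique (avoiders m)) → Unique (avoiders n)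
    step zero    _   = [] ∷ []
    step (suc n) rec = subst Unique (sym (avoiders-suc n))
      (Unique-map⁺-on injective (pairs-unique n (rec ∘ s≤s)))
      where
      sum-and-bound : ∀ {β γ} → (β , γ) ∈ pairs avoiders n → length β + length γ ≡ n × All (_< length β) β
      sum-and-bound {β} {γ} p∈
        with i , i≤n , β∈ , γ∈ ← Equivalence.to (∈-pairs⇔ {avoiders}) p∈
        with (refl , β< , _) , _ ← ∈-avoiders⁻ i β∈ | (lγ , _) , _ ← ∈-avoiders⁻ (n ∸ i) γ∈ =
        trans (cong (length β +_) lγ) (ℕ.m+[n∸m]≡n i≤n) , β<
      injective : ∀ {p q} → p ∈ pairs avoiders n → q ∈ pairs avoiders n →
                  uncurry assemble p ≡ uncurry assemble q → p ≡ q
      injective p∈ q∈ eq with sum₁ , β< ← sum-and-bound p∈ | sum₂ , β′< ← sum-and-bound q∈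
                         with refl , refl ← assemble-injective (trans sum₁ (sym sum₂)) β< β′< eq = refl


module Bivariate where

  open import Data.Nat using (zero; suc; _∸_)
  open import Data.Integer using (ℤ; +_)
  import Data.Integer as ℤ
  import Data.Integer.Properties as ℤ
  open import Data.List using (upTo)
  open ListSum ℤ.+-*-semiring using (∑)
  open import Data.List.Properties using (map-cong)
  open import Data.Maybe using (Maybe; just; nothing)
  open import Algebra.Bundles using (CommutativeRing)
  open import Algebra.Solver.Ring.AlmostCommutativeRing
    using (fromCommutativeRing; _-Raw-AlmostCommutative⟶_; Induced-equivalence)
  open import Relation.Nullary using (yes; no)
  open import Relation.Binary.PropositionalEquality as ≡ using (cong; cong₂)

  -- Series is definitionally ℤ⟦y⟧⟦x⟧.PS: power series in x whose coefficients are power series in y.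
  module ℤ⟦y⟧ = PowerSeries ℤ.+-*-commutativeRing
  module ℤ⟦y⟧⟦x⟧ = PowerSeries ℤ⟦y⟧.psRing

  ℤ⟦x,y⟧ : CommutativeRing _ _
  ℤ⟦x,y⟧ = ℤ⟦y⟧⟦x⟧.psRing

  open CommutativeRing ℤ⟦x,y⟧
    using (_≈_; _+_; _*_; _-_; 0#; +-congˡ; *-congˡ; *-cong; zeroʳ; +-identityʳ)
    renaming (refl to ≈-refl; trans to ≈-trans; sym to ≈-sym)

  ⟦_⟧ : ℤ → Series
  ⟦ c ⟧ = ℤ⟦y⟧⟦x⟧.C (ℤ⟦y⟧.C c)

  𝕏 𝕐 : Series
  𝕏 = ℤ⟦y⟧⟦x⟧.𝕩
  𝕐 = ℤ⟦y⟧⟦x⟧.C ℤ⟦y⟧.𝕩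

  ⟦⟧-homomorphism : CommutativeRing.rawRing ℤ.+-*-commutativeRing
                      -Raw-AlmostCommutative⟶ fromCommutativeRing ℤ⟦x,y⟧
  ⟦⟧-homomorphism = record
    { ⟦_⟧    = ⟦_⟧
    ; +-homo = λ a b → ≈-trans (ℤ⟦y⟧⟦x⟧.C-cong (ℤ⟦y⟧.C-+ a b)) (ℤ⟦y⟧⟦x⟧.C-+ _ _)
    ; *-homo = λ a b → ≈-trans (ℤ⟦y⟧⟦x⟧.C-cong (ℤ⟦y⟧.C-* a b)) (ℤ⟦y⟧⟦x⟧.C-* _ _)
    ; -‿homo = λ a → ≈-trans (ℤ⟦y⟧⟦x⟧.C-cong (ℤ⟦y⟧.C-neg a)) (ℤ⟦y⟧⟦x⟧.C-neg _)
    ; 0-homo = ≈-trans (ℤ⟦y⟧⟦x⟧.C-cong ℤ⟦y⟧.C-0) ℤ⟦y⟧⟦x⟧.C-0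
    ; 1-homo = ≈-trans (ℤ⟦y⟧⟦x⟧.C-cong ℤ⟦y⟧.C-1) ℤ⟦y⟧⟦x⟧.C-1
    }

  ⟦⟧-≟ : ∀ a b → Maybe (Induced-equivalence ⟦⟧-homomorphism a b)
  ⟦⟧-≟ a b with a ℤ.≟ b
  ... | yes ≡.refl = just ≈-refl
  ... | no _       = nothing

  open import Algebra.Solver.Ring (CommutativeRing.rawRing ℤ.+-*-commutativeRing)
    (fromCommutativeRing ℤ⟦x,y⟧) ⟦⟧-homomorphism ⟦⟧-≟
    using (solve; Polynomial; con; _:+_; _:-_; _:*_; _:=_)

  L : Series
  L = ⟦ + 1 ⟧ + 𝕏 - 𝕏 * 𝕐

  -- Names ending in ₑ are the solver expressions of the corresponding series.
  Lₑ : ∀ {m} → Polynomial m → Polynomial m → Polynomial m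
  Lₑ x y = con (+ 1) :+ x :- x :* y

  module Quadratic (H : Series)
    (H-eq : H ≈ ⟦ + 1 ⟧ + 𝕏 * (𝕐 * H) + 𝕏 * ((H - ⟦ + 1 ⟧) * H))
    (Φ-eq : (⟦ + 1 ⟧ - 𝕐) * Φ ≈ 𝕐 * H) where

    open import Relation.Binary.Reasoning.Setoid (CommutativeRing.setoid ℤ⟦x,y⟧)
    open import Algebra.Properties.Ring (CommutativeRing.ring ℤ⟦x,y⟧) using (x≈y⇒x∙y⁻¹≈ε)

    S : Series
    S = L - ⟦ + 2 ⟧ * (𝕏 * H)

    S*S : S * S ≈ L * L - ⟦ + 4 ⟧ * 𝕏
    S*S = begin
      S * S
        ≈⟨ solve 3 (λ x y h → Sₑ x y h :* Sₑ x y h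
                    := Lₑ x y :* Lₑ x y :- con (+ 4) :* x :+ con (+ 4) :* x :* (Eₑ x y h :- h))
                 ≈-refl 𝕏 𝕐 H ⟩
      L * L - ⟦ + 4 ⟧ * 𝕏 + ⟦ + 4 ⟧ * 𝕏 * (E - H)
        ≈⟨ +-congˡ {L * L - ⟦ + 4 ⟧ * 𝕏} (*-congˡ {⟦ + 4 ⟧ * 𝕏} (x≈y⇒x∙y⁻¹≈ε {E} {H} (≈-sym H-eq))) ⟩
      L * L - ⟦ + 4 ⟧ * 𝕏 + ⟦ + 4 ⟧ * 𝕏 * 0#
        ≈⟨ ≈-trans (+-congˡ {L * L - ⟦ + 4 ⟧ * 𝕏} (zeroʳ (⟦ + 4 ⟧ * 𝕏))) (+-identityʳ _) ⟩
      L * L - ⟦ + 4 ⟧ * 𝕏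
        ∎
      where
      Sₑ Eₑ : ∀ {m} → Polynomial m → Polynomial m → Polynomial m → Polynomial m
      Sₑ x y h = Lₑ x y :- con (+ 2) :* (x :* h)
      Eₑ x y h = con (+ 1) :+ x :* (y :* h) :+ x :* ((h :- con (+ 1)) :* h)
      E : Series
      E = ⟦ + 1 ⟧ + 𝕏 * (𝕐 * H) + 𝕏 * ((H - ⟦ + 1 ⟧) * H)

    2𝕏[1-𝕐]Φ : ⟦ + 2 ⟧ * (𝕏 * ((⟦ + 1 ⟧ - 𝕐) * Φ)) ≈ 𝕐 * L - 𝕐 * S
    2𝕏[1-𝕐]Φ = begin
      ⟦ + 2 ⟧ * (𝕏 * ((⟦ + 1 ⟧ - 𝕐) * Φ))   ≈⟨ *-congˡ {⟦ + 2 ⟧} (*-congˡ {𝕏} Φ-eq) ⟩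
      ⟦ + 2 ⟧ * (𝕏 * (𝕐 * H))               ≈⟨ solve 3 (λ x y h → con (+ 2) :* (x :* (y :* h))
                                                  := y :* Lₑ x y :- y :* (Lₑ x y :- con (+ 2) :* (x :* h)))
                                                  ≈-refl 𝕏 𝕐 H ⟩
      𝕐 * L - 𝕐 * S                         ∎

  ⊗-≈ : ∀ {A A′ B B′} → A ≈ A′ → B ≈ B′ → A ⊗ B ≈ A′ * B′
  ⊗-≈ {A} {A′} {B} {B′} A≈A′ B≈B′ n k = begin
    (A ⊗ B) n k
      ≡⟨ cong sumℤ (map-cong (λ i → ≡.sym (ℤ⟦y⟧.*ₚ-coeff (A i) (B (n ∸ i)) k)) (upTo (suc n))) ⟩
    ∑ (upTo (suc n)) (λ i → (A i ℤ⟦y⟧.*ₚ B (n ∸ i)) k)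
      ≡⟨ ≡.sym (≡.trans (ℤ⟦y⟧⟦x⟧.*ₚ-coeff A B n k)
                        (ℤ⟦y⟧.∑-coeff (upTo (suc n)) (λ i → A i ℤ⟦y⟧.*ₚ B (n ∸ i)) k)) ⟩
    (A * B) n k
      ≡⟨ *-cong A≈A′ B≈B′ n k ⟩
    (A′ * B′) n k
      ∎
    where open ≡.≡-Reasoning

  ⊕-≈ : ∀ {A A′ B B′} → A ≈ A′ → B ≈ B′ → A ⊕ B ≈ A′ + B′
  ⊕-≈ A≈A′ B≈B′ n k = cong₂ ℤ._+_ (A≈A′ n k) (B≈B′ n k)

  ⊖-≈ : ∀ {A A′ B B′} → A ≈ A′ → B ≈ B′ → A ⊖ B ≈ A′ - B′
  ⊖-≈ A≈A′ B≈B′ n k = cong₂ ℤ._-_ (A≈A′ n k) (B≈B′ n k)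

  const-≈ : ∀ c → const c ≈ ⟦ c ⟧
  const-≈ c zero    zero    = ≡.refl
  const-≈ c zero    (suc k) = ≡.refl
  const-≈ c (suc n) k       = ≡.refl

  X-≈ : X ≈ 𝕏
  X-≈ zero          k       = ≡.refl
  X-≈ (suc zero)    zero    = ≡.refl
  X-≈ (suc zero)    (suc k) = ≡.refl
  X-≈ (suc (suc n)) k       = ≡.refl

  Y-≈ : Y ≈ 𝕐
  Y-≈ zero    zero          = ≡.refl
  Y-≈ zero    (suc zero)    = ≡.refl
  Y-≈ zero    (suc (suc k)) = ≡.refl
  Y-≈ (suc n) k             = ≡.refl

  L-≈ : (const (+ 1) ⊕ X) ⊖ (X ⊗ Y) ≈ L
  L-≈ = ⊖-≈ (⊕-≈ (const-≈ (+ 1)) X-≈) (⊗-≈ X-≈ Y-≈)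

  Disc-≈ : Disc ≈ L * L - ⟦ + 4 ⟧ * 𝕏
  Disc-≈ = ⊖-≈ (⊗-≈ L-≈ L-≈) (⊗-≈ (const-≈ (+ 4)) X-≈)

  2x[1-y]Φ-≈ : const (+ 2) ⊗ (X ⊗ ((const (+ 1) ⊖ Y) ⊗ Φ)) ≈ ⟦ + 2 ⟧ * (𝕏 * ((⟦ + 1 ⟧ - 𝕐) * Φ))
  2x[1-y]Φ-≈ = ⊗-≈ (const-≈ (+ 2)) (⊗-≈ X-≈ (⊗-≈ (⊖-≈ (const-≈ (+ 1)) Y-≈) ≈-refl))

  yL-yS-≈ : ∀ S → (Y ⊗ ((const (+ 1) ⊕ X) ⊖ (X ⊗ Y))) ⊖ (Y ⊗ S) ≈ 𝕐 * L - 𝕐 * S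
  yL-yS-≈ S = ⊖-≈ (⊗-≈ Y-≈ L-≈) (⊗-≈ Y-≈ ≈-refl)

  S⊗S-≈ : ∀ S → S ⊗ S ≈ S * S
  S⊗S-≈ S = ⊗-≈ ≈-refl ≈-refl


module GeneratingFunction where

  open import Data.Nat using (ℕ; zero; suc; _∸_; _<_; _<ᵇ_)
  open import Data.Integer using (+_)
  import Data.Integer as ℤ
  import Data.Integer.Properties as ℤ
  open import Data.Bool using (Bool; true; false; _∧_; if_then_else_)
  open import Data.Bool.Properties using (∧-conicalˡ; ∧-conicalʳ) renaming (_≟_ to _≟B_)
  open import Data.List using ([]; _∷_; [_]; length; filter; cartesianProduct; upTo; applyUpTo)
  open import Data.List.Membership.Propositional using (_∈_)
  open import Data.List.Membership.Propositional.Properties using (∈-filter⁺; ∈-filter⁻; ∈-applyUpTo⁻)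
  import Data.List.Relation.Unary.Unique.Propositional.Properties as Unique
  open import Data.Product using (_,_; uncurry)
  open import Data.List.Relation.Unary.All using (All)
  open import Function using (mk⇔; _∘_)
  open import Function.Bundles using (module Equivalence)
  open import Relation.Binary.PropositionalEquality as ≡ using (_≡_; refl; cong; cong₂)
  open import Algebra.Bundles using (CommutativeRing)
  open UniqueLists
  open Patterns
  open LongestDecreasing
  open Permutations
  open Avoiders
  open Bivariate
  open ℤ⟦y⟧ using (PS; _≋_; _*ₚ_; _+ₚ_; -ₚ_; 1ₚ; 𝕩; mono; geom)

  module ℤy = CommutativeRing ℤ⟦y⟧.psRing
  module Σℤ = ListSum ℤ.+-*-semiring
  open ListSum (CommutativeRing.semiring ℤ⟦y⟧.psRing)

  length-filter≡∑ : ∀ {A : Set} (p : A → Bool) xs →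
                 + length (filter (λ x → p x ≟B true) xs) ≡ Σℤ.∑ xs (λ x → if p x then + 1 else + 0)
  length-filter≡∑ p []       = refl
  length-filter≡∑ p (x ∷ xs) with p x
  ... | true  = cong (ℤ._+_ (+ 1)) (length-filter≡∑ p xs)
  ... | false = ≡.trans (length-filter≡∑ p xs) (≡.sym (ℤ.+-identityˡ _))

  f-dec≡count : ∀ k n → f (dec k) n ≡ length (filter (λ w → (lds w <ᵇ k) ≟B true) (avoiders n))
  f-dec≡count k n =
    Unique⇒length≡ (Unique.filter⁺ _ (Sym-unique n)) (Unique.filter⁺ _ (avoiders-unique n)) (mk⇔ to from)
    where
    to : ∀ {w} → w ∈ filter _ (Sym n) → w ∈ filter _ (avoiders n)
    to w∈ with w∈Sym , avoids-both ← ∈-filter⁻ _ {xs = Sym n} w∈ =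
      ∈-filter⁺ _ (∈-avoiders⁺ n (Equivalence.to (∈-Sym⇔ n) w∈Sym ,
                                  Equivalence.to (avoids-132⇔ _) (∧-conicalˡ _ _ avoids-both)))
                  (≡.trans (≡.sym (avoids-dec _ k)) (∧-conicalʳ _ _ avoids-both))
    from : ∀ {w} → w ∈ filter _ (avoiders n) → w ∈ filter _ (Sym n)
    from w∈ with w∈avoiders , lds<k ← ∈-filter⁻ _ {xs = avoiders n} w∈
            with perm , ∌132 ← ∈-avoiders⁻ n w∈avoiders =
      ∈-filter⁺ _ (Equivalence.from (∈-Sym⇔ n) perm)
                  (cong₂ _∧_ (Equivalence.from (avoids-132⇔ _) ∌132) (≡.trans (avoids-dec _ k) lds<k))

  H : Series
  H n = ∑[ w ∈ avoiders n ] mono (lds w)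

  Φ-as-sum : ∀ n → Φ n ≋ ∑[ w ∈ avoiders n ] geom (lds w)
  Φ-as-sum n zero    =
    ≡.sym (≡.trans (ℤ⟦y⟧.∑-coeff (avoiders n) (geom ∘ lds) 0) (Σℤ.∑-zero (avoiders n)))
  Φ-as-sum n (suc k) = ≡.trans (cong +_ (f-dec≡count (suc k) n))
    (≡.trans (length-filter≡∑ (λ w → lds w <ᵇ suc k) (avoiders n))
             (≡.sym (ℤ⟦y⟧.∑-coeff (avoiders n) (geom ∘ lds) (suc k))))

  1-𝕩-*ₚ-Φ : ∀ n → (1ₚ +ₚ -ₚ 𝕩) *ₚ Φ n ≋ 𝕩 *ₚ H n
  1-𝕩-*ₚ-Φ n = begin
    (1ₚ +ₚ -ₚ 𝕩) *ₚ Φ n                                ≈⟨ ℤy.*-congˡ (Φ-as-sum n) ⟩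
    (1ₚ +ₚ -ₚ 𝕩) *ₚ (∑[ w ∈ avoiders n ] geom (lds w)) ≈⟨ *-distribˡ-∑ _ (avoiders n) _ ⟩
    ∑[ w ∈ avoiders n ] (1ₚ +ₚ -ₚ 𝕩) *ₚ geom (lds w)   ≈⟨ ∑-cong (avoiders n) (λ {w} _ → ℤ⟦y⟧.1-𝕩-*ₚ-geom (lds w)) ⟩
    ∑[ w ∈ avoiders n ] mono (suc (lds w))              ≈⟨ ∑-cong (avoiders n) (λ {w} _ → ℤ⟦y⟧.mono-suc (lds w)) ⟩
    ∑[ w ∈ avoiders n ] 𝕩 *ₚ mono (lds w)               ≈⟨ *-distribˡ-∑ 𝕩 (avoiders n) _ ⟨
    𝕩 *ₚ H n                                            ∎
    where open import Relation.Binary.Reasoning.Setoid ℤy.setoid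

  module ℤxy = CommutativeRing ℤ⟦x,y⟧
  open ℤxy using (_≈_; _+_; _*_; _-_)

  Φ-eq : (⟦ + 1 ⟧ - 𝕐) * Φ ≈ 𝕐 * H
  Φ-eq n = begin
    ((⟦ + 1 ⟧ - 𝕐) * Φ) n                   ≈⟨ ℤ⟦y⟧⟦x⟧.*ₚ-cong 1-𝕐 (λ _ → ℤy.refl) n ⟩
    (ℤ⟦y⟧⟦x⟧.C (1ₚ +ₚ -ₚ 𝕩) * Φ) n          ≈⟨ ℤ⟦y⟧⟦x⟧.C-*ₚ _ Φ n ⟩
    (1ₚ +ₚ -ₚ 𝕩) *ₚ Φ n                     ≈⟨ 1-𝕩-*ₚ-Φ n ⟩
    𝕩 *ₚ H n                                ≈⟨ ℤ⟦y⟧⟦x⟧.C-*ₚ 𝕩 H n ⟨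
    (𝕐 * H) n                               ∎
    where
    open import Relation.Binary.Reasoning.Setoid ℤy.setoid
    1-𝕐 : ⟦ + 1 ⟧ - 𝕐 ≈ ℤ⟦y⟧⟦x⟧.C (1ₚ +ₚ -ₚ 𝕩)
    1-𝕐 = ℤxy.sym (ℤxy.trans (ℤ⟦y⟧⟦x⟧.C-cong (ℤy.+-congʳ (ℤy.sym ℤ⟦y⟧.C-1)))
                   (ℤxy.trans (ℤ⟦y⟧⟦x⟧.C-+ (ℤ⟦y⟧.C (+ 1)) (-ₚ 𝕩))
                              (ℤxy.+-congˡ {ℤ⟦y⟧⟦x⟧.C (ℤ⟦y⟧.C (+ 1))} (ℤ⟦y⟧⟦x⟧.C-neg 𝕩))))

  avoider-values : ∀ n {w} → w ∈ avoiders n → All (_< length w) w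
  avoider-values n w∈ with (refl , w< , _) , _ ← ∈-avoiders⁻ n w∈ = w<

  H-zero : H 0 ≋ ℤ⟦y⟧.C (+ 1)
  H-zero = ℤy.trans (ℤy.+-identityʳ (mono 0)) (ℤy.trans ℤ⟦y⟧.mono-zero (ℤy.sym ℤ⟦y⟧.C-1))

  module _ (n : ℕ) where
    open import Relation.Binary.Reasoning.Setoid ℤy.setoid

    block : ℕ → PS
    block i = ∑ (cartesianProduct (avoiders i) (avoiders (n ∸ i))) (mono ∘ lds ∘ uncurry assemble)

    convolution-tail : PS
    convolution-tail = ∑[ i ∈ applyUpTo suc n ] H i *ₚ H (n ∸ i)

    H-blocks : H (suc n) ≋ ∑[ i ∈ upTo (suc n) ] block i
    H-blocks = begin
      H (suc n)                                                ≡⟨ cong (λ ws → ∑ ws (mono ∘ lds)) (avoiders-suc n) ⟩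
      ∑ (map (uncurry assemble) (pairs avoiders n)) (mono ∘ lds) ≈⟨ ∑-map _ (pairs avoiders n) _ ⟩
      ∑ (pairs avoiders n) (mono ∘ lds ∘ uncurry assemble)     ≈⟨ ∑-concatMap blocks (upTo (suc n)) _ ⟩
      ∑[ i ∈ upTo (suc n) ] block i                            ∎
      where
      blocks : ℕ → List (List ℕ × List ℕ)
      blocks i = cartesianProduct (avoiders i) (avoiders (n ∸ i))

    block-zero : block 0 ≋ 𝕩 *ₚ H n
    block-zero = begin
      block 0                                          ≈⟨ ∑-cartesianProduct [ [] ] (avoiders n) _ ⟩
      (∑[ γ ∈ avoiders n ] mono (lds (assemble [] γ))) +ₚ ℤ⟦y⟧.0ₚ
                                                       ≈⟨ ℤy.+-identityʳ _ ⟩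
      ∑[ γ ∈ avoiders n ] mono (lds (assemble [] γ))   ≈⟨ ∑-cong (avoiders n) shifted ⟩
      ∑[ γ ∈ avoiders n ] 𝕩 *ₚ mono (lds γ)            ≈⟨ *-distribˡ-∑ 𝕩 (avoiders n) _ ⟨
      𝕩 *ₚ H n                                         ∎
      where
      shifted : ∀ {γ} → γ ∈ avoiders n → mono (lds (assemble [] γ)) ≋ 𝕩 *ₚ mono (lds γ)
      shifted {γ} γ∈ = ℤy.trans (ℤy.reflexive (cong mono (lds-assemble-[] γ (avoider-values n γ∈))))
                                (ℤ⟦y⟧.mono-suc (lds γ))

    block-suc : ∀ i → block (suc i) ≋ H (suc i) *ₚ H (n ∸ suc i)
    block-suc i = begin
      block (suc i)                     ≈⟨ ∑-cartesianProduct (avoiders (suc i)) (avoiders m) _ ⟩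
      ∑[ β ∈ avoiders (suc i) ] ∑[ γ ∈ avoiders m ] mono (lds (assemble β γ))
                                        ≈⟨ ∑-cong (avoiders (suc i)) factor ⟩
      ∑[ β ∈ avoiders (suc i) ] ∑[ γ ∈ avoiders m ] mono (lds β) *ₚ mono (lds γ)
                                        ≈⟨ ∑-*-∑ (avoiders (suc i)) (avoiders m) _ _ ⟨
      H (suc i) *ₚ H m                  ∎
      where
      m = n ∸ suc i
      factor : ∀ {β} → β ∈ avoiders (suc i) →
               ∑[ γ ∈ avoiders m ] mono (lds (assemble β γ)) ≋ ∑[ γ ∈ avoiders m ] mono (lds β) *ₚ mono (lds γ)
      factor {[]}    β∈ with (() , _) , _ ← ∈-avoiders⁻ (suc i) β∈
      factor {x ∷ β} β∈ = ∑-cong (avoiders m) λ {γ} γ∈ → ℤy.trans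
        (ℤy.reflexive (cong mono (lds-assemble-∷ x β γ (avoider-values (suc i) β∈) (avoider-values m γ∈))))
        (ℤ⟦y⟧.mono-+ (lds (x ∷ β)) (lds γ))

    H-suc : H (suc n) ≋ 𝕩 *ₚ H n +ₚ convolution-tail
    H-suc = ℤy.trans H-blocks (ℤy.+-cong block-zero (∑-cong (applyUpTo suc n) blocks))
      where
      blocks : ∀ {j} → j ∈ applyUpTo suc n → block j ≋ H j *ₚ H (n ∸ j)
      blocks j∈ with i , _ , refl ← ∈-applyUpTo⁻ suc j∈ = block-suc i

    [H-1]*H : ((H - ⟦ + 1 ⟧) * H) n ≋ convolution-tail
    [H-1]*H = begin
      ((H - ⟦ + 1 ⟧) * H) n                 ≈⟨ ℤ⟦y⟧⟦x⟧.*ₚ-coeff (H - ⟦ + 1 ⟧) H n ⟩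
      (H - ⟦ + 1 ⟧) 0 *ₚ H n +ₚ (∑[ i ∈ applyUpTo suc n ] (H - ⟦ + 1 ⟧) i *ₚ H (n ∸ i))
                                            ≈⟨ ℤy.+-cong first (∑-cong (applyUpTo suc n) rest) ⟩
      ℤ⟦y⟧.0ₚ +ₚ convolution-tail           ≈⟨ ℤy.+-identityˡ _ ⟩
      convolution-tail                      ∎
      where
      open import Algebra.Properties.Ring ℤy.ring using (-0#≈0#)
      first : (H - ⟦ + 1 ⟧) 0 *ₚ H n ≋ ℤ⟦y⟧.0ₚ
      first = ℤy.trans (ℤy.*-congʳ {H n} (ℤy.trans (ℤy.+-congʳ H-zero) (ℤy.-‿inverseʳ (ℤ⟦y⟧.C (+ 1)))))
                       (ℤy.zeroˡ (H n))
      rest : ∀ {j} → j ∈ applyUpTo suc n → (H - ⟦ + 1 ⟧) j *ₚ H (n ∸ j) ≋ H j *ₚ H (n ∸ j)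
      rest j∈ with i , _ , refl ← ∈-applyUpTo⁻ suc j∈ =
        ℤy.*-congʳ {H (n ∸ suc i)} (ℤy.trans (ℤy.+-congˡ {H (suc i)} -0#≈0#) (ℤy.+-identityʳ _))

    equation-suc : (⟦ + 1 ⟧ + 𝕏 * (𝕐 * H) + 𝕏 * ((H - ⟦ + 1 ⟧) * H)) (suc n) ≋
                   𝕩 *ₚ H n +ₚ convolution-tail
    equation-suc = begin
      (⟦ + 1 ⟧ + 𝕏 * (𝕐 * H) + 𝕏 * ((H - ⟦ + 1 ⟧) * H)) (suc n)
        ≈⟨ ℤy.+-cong (ℤy.+-congˡ {ℤ⟦y⟧.0ₚ} (ℤ⟦y⟧⟦x⟧.𝕩-*ₚ (𝕐 * H) (suc n)))
                     (ℤ⟦y⟧⟦x⟧.𝕩-*ₚ ((H - ⟦ + 1 ⟧) * H) (suc n)) ⟩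
      (ℤ⟦y⟧.0ₚ +ₚ (𝕐 * H) n) +ₚ ((H - ⟦ + 1 ⟧) * H) n
        ≈⟨ ℤy.+-cong (ℤy.trans (ℤy.+-identityˡ _) (ℤ⟦y⟧⟦x⟧.C-*ₚ 𝕩 H n)) [H-1]*H ⟩
      𝕩 *ₚ H n +ₚ convolution-tail
        ∎

  H-eq : H ≈ ⟦ + 1 ⟧ + 𝕏 * (𝕐 * H) + 𝕏 * ((H - ⟦ + 1 ⟧) * H)
  H-eq zero    = ℤy.trans H-zero (ℤy.sym (ℤy.trans
    (ℤy.+-cong (ℤy.+-congˡ {ℤ⟦y⟧.C (+ 1)} (ℤ⟦y⟧⟦x⟧.𝕩-*ₚ (𝕐 * H) 0))
               (ℤ⟦y⟧⟦x⟧.𝕩-*ₚ ((H - ⟦ + 1 ⟧) * H) 0))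
    (ℤy.trans (ℤy.+-identityʳ _) (ℤy.+-identityʳ _))))
  H-eq (suc n) = ℤy.trans (H-suc n) (ℤy.sym (equation-suc n))


open import Data.Integer using (+_)
open Bivariate
open GeneratingFunction using (H; H-eq; Φ-eq)

theorem2p2 : Σ Series (λ S →
               (S 0 0 ≡ + 1)
               × ((n k : ℕ) → (S ⊗ S) n k ≡ Disc n k)
               × ((n k : ℕ) →
                    (const (+ 2) ⊗ (X ⊗ ((const (+ 1) ⊖ Y) ⊗ Φ))) n k
                      ≡ ((Y ⊗ ((const (+ 1) ⊕ X) ⊖ (X ⊗ Y))) ⊖ (Y ⊗ S)) n k))
theorem2p2 = S , ≡.refl
           , (λ n k → ≡.trans (S⊗S-≈ S n k) (≡.trans (S*S n k) (≡.sym (Disc-≈ n k))))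
           , (λ n k → ≡.trans (2x[1-y]Φ-≈ n k) (≡.trans (2𝕏[1-𝕐]Φ n k) (≡.sym (yL-yS-≈ S n k))))
  where open Quadratic H H-eq Φ-eq
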